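{- Let $M$ be a matroid and let $\mathbf{Q}=(L,Q_1,Q_2,\ldots,Q_n,R)$ be a $(4,2)$-flexipath in $M$ with $n\ge 5$ internal steps. If $\mathbf{Q}$ has no specially placed step, let $\mathbf{Q}'=\mathbf{Q}$; otherwise let $\mathbf{Q}'$ be obtained from $\mathbf{Q}$ by absorbing its specially placed step into its right end. Then $\mathbf{Q}'$ is spike-reminiscent, paddle-reminiscent, squashed, or stretched.
   Context: Let $M$ be a matroid on ground set $E$ with rank function $r$. For $A\subseteq E$, $\lambda(A)=\lambda_M(A)=r(A)+r(E-A)-r(M)$. For disjoint $X,Y\subseteq E$, $\sqcap(X,Y)=r(X)+r(Y)-r(X\cup Y)$ and $\sqcap^*(X,Y)$ denotes the same quantity computed in the dual matroid $M^*$. Also $\kappa(X,Y)=\min\{\lambda_M(Z): X\subseteq Z\subseteq E-Y\}$. A path of $4$-separations in $M$ is an ordered partition $(L,P_1,\ldots,P_n,R)$ of $E$ with $\kappa(L,R)=3$ and $\lambda_M(L\cup P_1\cup\cdots\cup P_i)=3$ for all $i\in\{0,1,\ldots,n\}$; $L,R$ are the end steps and $P_1,\ldots,P_n$ the internal steps. It is a $4$-flexipath if $(L,Q_1,\ldots,Q_n,R)$ is a path of $4$-separations for every permutation $(Q_1,\ldots,Q_n)$ of $(P_1,\ldots,P_n)$. For a positive integer $c$, a $4$-flexipath is a $(4,c)$-flexipath if $\lambda(P_i)=c$ for all $i$ and $\lambda(P_i\cup P_j)>c$ for all distinct $i,j$. Absorbing the internal step $Q_i$ of $(L,Q_1,\ldots,Q_n,R)$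 into the right end produces $(L,Q_1,\ldots,Q_{i-1},Q_{i+1},\ldots,Q_n,Q_i\cup R)$. For a $(4,2)$-flexipath $\mathbf{Q}=(L,Q_1,\ldots,Q_n,R)$: a step $Q_i$ is specially placed if either $\sqcap(L,R)=2$ and $\sqcap(L,Q_i)=2=\sqcap(R,Q_i)$, or $\sqcap^*(L,R)=2$ and $\sqcap^*(L,Q_i)=2=\sqcap^*(R,Q_i)$. Say condition (B) holds if $\sqcap(Q_i,L)=\sqcap(Q_i,R)=\sqcap^*(Q_i,L)=\sqcap^*(Q_i,R)=1$ for all $i\in[n]$. Then $\mathbf{Q}$ is - spike-reminiscent if $\sqcap(L,R)=1$, $\sqcap^*(L,R)=2$, $\sqcap(Q_i,Q_j)=1$ and $\sqcap^*(Q_i,Q_j)=0$ for all distinct $i,j\in[n]$, and (B) holds; - paddle-reminiscent if $\sqcap(L,R)=2$, $\sqcap^*(L,R)=1$, $\sqcap(Q_i,Q_j)=0$ and $\sqcap^*(Q_i,Q_j)=1$ for all distinct $i,j$, and (B) holds; - squashed if $\sqcap(L,R)=3$, $\sqcap^*(L,R)=0$, $\sqcap(Q_i,Q_j)=1$ and $\sqcap^*(Q_i,Q_j)=0$ for all distinct $i,j$, and $\sqcap(Q_i,L)=\sqcap(Q_i,R)=2$, $\sqcap^*(Q_i,L)=\sqcap^*(Q_i,R)=0$ for all $i$; - stretched if $\sqcap(L,R)=0$, $\sqcap^*(L,R)=3$, $\sqcap(Q_i,Q_j)=0$ and $\sqcap^*(Q_i,Q_j)=1$ for all distinct $i,j$,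 and $\sqcap(Q_i,L)=\sqcap(Q_i,R)=0$, $\sqcap^*(Q_i,L)=\sqcap^*(Q_i,R)=2$ for all $i$. -}

module Defs where

open import Data.Nat using (ℕ; zero; suc; _+_; _∸_; _≤_)
open import Data.Fin using (Fin; punchIn)
open import Data.Fin.Subset using (Subset; _∪_; _∩_; ∁; ⊤; ⊥; ⋃; ∣_∣; _⊆_)
open import Data.Fin.Permutation using (Permutation′; _⟨$⟩ʳ_)
open import Data.List using (List; map; take; allFin)
open import Data.Product using (_×_; Σ; ∃)
open import Data.Sum using (_⊎_)
open import Relation.Binary.PropositionalEquality using (_≡_; _≢_)

record Matroid : Set where
  field
    size : ℕ
    r    : Subset size → ℕ
    r-card    : ∀ X → r X ≤ ∣ X ∣
    r-mono    : ∀ X Y → X ⊆ Y → r X ≤ r Y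
    r-submod  : ∀ X Y → r (X ∪ Y) + r (X ∩ Y) ≤ r X + r Y

module _ (M : Matroid) where
  open Matroid M

  E : Subset size
  E = ⊤

  rM : ℕ
  rM = r E

  -- rank function of the dual matroid: r*(X) = |X| + r(E - X) - r(M)
  -- (truncated subtraction is exact here since |X| + r(E-X) ≥ r(E))
  r* : Subset size → ℕ
  r* X = (∣ X ∣ + r (∁ X)) ∸ rM

  λM : Subset size → ℕ
  λM A = (r A + r (∁ A)) ∸ rM

  ⊓ : Subset size → Subset size → ℕ
  ⊓ X Y = (r X + r Y) ∸ r (X ∪ Y)

  ⊓* : Subset size → Subset size → ℕ
  ⊓* X Y = (r* X + r* Y) ∸ r* (X ∪ Y)

  Disjoint : Subset size → Subset size → Set
  Disjoint X Y = X ∩ Y ≡ ⊥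

  κ≡ : Subset size → Subset size → ℕ → Set
  κ≡ X Y k =
    (Σ (Subset size) λ Z → X ⊆ Z × Disjoint Z Y × λM Z ≡ k)
    × (∀ Z → X ⊆ Z → Disjoint Z Y → k ≤ λM Z)

  OrderedPartition : {n : ℕ} → Subset size → (Fin n → Subset size) → Subset size → Set
  OrderedPartition {n} L P R =
    Disjoint L R
    × (∀ i → Disjoint L (P i))
    × (∀ i → Disjoint (P i) R)
    × (∀ i j → i ≢ j → Disjoint (P i) (P j))
    × ((L ∪ ⋃ (map P (allFin n))) ∪ R ≡ E)

  prefix : {n : ℕ} → Subset size → (Fin n → Subset size) → ℕ → Subset size
  prefix {n} L P k = L ∪ ⋃ (map P (take k (allFin n)))

  PathOf4Seps : {n : ℕ} → Subset size → (Fin n → Subset size) → Subset size → Set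
  PathOf4Seps {n} L P R =
    OrderedPartition L P R
    × κ≡ L R 3
    × (∀ k → k ≤ n → λM (prefix L P k) ≡ 3)

  Flexipath4 : {n : ℕ} → Subset size → (Fin n → Subset size) → Subset size → Set
  Flexipath4 {n} L P R = (π : Permutation′ n) → PathOf4Seps L (λ i → P (π ⟨$⟩ʳ i)) R

  Flexipath4c : ℕ → {n : ℕ} → Subset size → (Fin n → Subset size) → Subset size → Set
  Flexipath4c c L P R =
    Flexipath4 L P R
    × (∀ i → λM (P i) ≡ c)
    × (∀ i j → i ≢ j → suc c ≤ λM (P i ∪ P j))

  SpeciallyPlaced : {n : ℕ} → Subset size → (Fin n → Subset size) → Subset size → Fin n → Set
  SpeciallyPlaced L Q R i =
    (⊓ L R ≡ 2 × ⊓ L (Q i) ≡ 2 × ⊓ R (Q i) ≡ 2)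
    ⊎ (⊓* L R ≡ 2 × ⊓* L (Q i) ≡ 2 × ⊓* R (Q i) ≡ 2)

  CondB : {n : ℕ} → Subset size → (Fin n → Subset size) → Subset size → Set
  CondB L Q R = ∀ i → ⊓ (Q i) L ≡ 1 × ⊓ (Q i) R ≡ 1 × ⊓* (Q i) L ≡ 1 × ⊓* (Q i) R ≡ 1

  SpikeReminiscent : {n : ℕ} → Subset size → (Fin n → Subset size) → Subset size → Set
  SpikeReminiscent L Q R =
    ⊓ L R ≡ 1 × ⊓* L R ≡ 2
    × (∀ i j → i ≢ j → ⊓ (Q i) (Q j) ≡ 1 × ⊓* (Q i) (Q j) ≡ 0)
    × CondB L Q R

  PaddleReminiscent : {n : ℕ} → Subset size → (Fin n → Subset size) → Subset size → Set
  PaddleReminiscent L Q R =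
    ⊓ L R ≡ 2 × ⊓* L R ≡ 1
    × (∀ i j → i ≢ j → ⊓ (Q i) (Q j) ≡ 0 × ⊓* (Q i) (Q j) ≡ 1)
    × CondB L Q R

  Squashed : {n : ℕ} → Subset size → (Fin n → Subset size) → Subset size → Set
  Squashed L Q R =
    ⊓ L R ≡ 3 × ⊓* L R ≡ 0
    × (∀ i j → i ≢ j → ⊓ (Q i) (Q j) ≡ 1 × ⊓* (Q i) (Q j) ≡ 0)
    × (∀ i → ⊓ (Q i) L ≡ 2 × ⊓ (Q i) R ≡ 2 × ⊓* (Q i) L ≡ 0 × ⊓* (Q i) R ≡ 0)

  Stretched : {n : ℕ} → Subset size → (Fin n → Subset size) → Subset size → Set
  Stretched L Q R =
    ⊓ L R ≡ 0 × ⊓* L R ≡ 3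
    × (∀ i j → i ≢ j → ⊓ (Q i) (Q j) ≡ 0 × ⊓* (Q i) (Q j) ≡ 1)
    × (∀ i → ⊓ (Q i) L ≡ 0 × ⊓ (Q i) R ≡ 0 × ⊓* (Q i) L ≡ 2 × ⊓* (Q i) R ≡ 2)

  OfFourTypes : {n : ℕ} → Subset size → (Fin n → Subset size) → Subset size → Set
  OfFourTypes L Q R =
    SpikeReminiscent L Q R ⊎ PaddleReminiscent L Q R ⊎ Squashed L Q R ⊎ Stretched L Q R

  -- Absorbing the internal step Q_i into the right end:
  -- (L, Q_1..Q_{i-1}, Q_{i+1}..Q_n, Q_i ∪ R); then test the four types.
  AbsorbedOfFourTypes : {n : ℕ} → Subset size → (Fin n → Subset size) → Subset size → Fin n → Set
  AbsorbedOfFourTypes {suc k} L Q R i = OfFourTypes L (λ j → Q (punchIn i j)) (Q i ∪ R)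

{-# OPTIONS --safe #-}
module Submission where

-- Write x i = ⊓(Q i, L) and x* i = ⊓*(Q i, L).  Reordering the flexipath makes every L ∪ Q i a
-- 4-separation between L and R; such separations form a lattice, so L together with any union Y of
-- steps is one too, and then ⊓(Y, L) + ⊓*(Y, L) = λ(Y).  In particular x i + x* i = 2.  Comparing
-- two disjoint pairs of steps (here n ≥ 5 is used) shows that λ(Q i ∪ Q j) = 3 and that
-- α = ⊓(Q i ∪ Q j, L) does not depend on the pair; the chain rule then gives
-- α + ⊓(Q i, Q j) = x i + x j and ⊓(Q i, Q j) + ⊓*(Q i, Q j) = 1.  The ends are read off from
-- ⊓(L, R) + ⊓*(O, L) = 3 = ⊓*(L, R) + ⊓(O, L) for O = E - (L ∪ R), the union of all steps, whose
-- connectivities to L are bounded through the chain rule and the submodularity of ⊓(-, L) on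
-- these separations.  Now α = 0 and α = 3 give stretched and squashed paths.  If α = 1 then
-- x i ≤ 1 and at most one step has x m = 0; without such a step the path is spike-reminiscent,
-- and otherwise Q m is the only specially placed step and absorbing it into R leaves a
-- spike-reminiscent path.  The case α = 2 is dual, with x m = 2 and paddle-reminiscent paths.

open import Defs
open import Data.Nat using (ℕ; _≤_)
open import Data.Fin using (Fin)
open import Data.Fin.Subset using (Subset)
open import Data.Product using (_×_)
open import Relation.Nullary using (¬_)

open import Data.Nat using (zero; suc; _+_; _∸_; _<_; z≤n; s≤s) renaming (_≟_ to _≟ℕ_)
open import Data.Nat.Properties
  using ( +-comm; +-assoc; +-identityʳ; +-suc; +-cancelʳ-≡; +-cancelˡ-≡; +-cancelʳ-≤; +-cancelˡ-≤
        ; +-mono-≤; +-monoˡ-≤; +-monoʳ-≤; ≤-trans; ≤-reflexive; ≤-antisym; m≤m+n; m≤n+m; m∸n+n≡m; m+n∸n≡m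
        ; ≮⇒≥; ≤⇒≯; ≤-<-trans; m≤n⇒m≤1+n; ∸-monoˡ-≤; n≤0⇒n≡0; module ≤-Reasoning )
open import Data.Nat.Tactic.RingSolver using (solve)
open import Data.Bool using (Bool; true; false; _∧_; _∨_; not; T)
open import Data.Bool.Properties using (T-∧) renaming (_≟_ to _≟ᵇ_)
open import Data.Bool.ListAction using (any)
open import Data.Fin using (zero; suc; punchIn; punchOut)
open import Data.Fin.Properties
  using (_≟_; any?; pigeonhole; <-irrefl; punchInᵢ≢i; punchIn-punchOut; punchIn-injective)
open import Data.Fin.Permutation using (id; transpose)
open import Data.Fin.Subset using (_∪_; _∩_; ∁; ⊤; ⊥; ⋃; ∣_∣; _⊆_; _∈_)
open import Data.Fin.Subset.Properties
  using (p∪∁p≡⊤; p⊆p∪q; x∈p∪q⁺; x∈p∪q⁻; x∈p∩q⁻; ∉⊥; ⊥⊆; ⊆-antisym; x∈∁p⇒x∉p)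
open import Data.List using (List; []; _∷_; length; allFin; tabulate) renaming (lookup to lookupₗ; map to mapₗ)
open import Data.List.Properties using (map-tabulate)
open import Data.List.Membership.Propositional using () renaming (_∈_ to _∈ₗ_)
open import Data.List.Relation.Unary.All using (All; []; _∷_; all?)
open import Data.List.Relation.Unary.AllPairs using (AllPairs; []; _∷_)
open import Data.List.Relation.Unary.Any using (Any; index; here; there) renaming (map to mapₐ)
import Data.List.Relation.Unary.All.Properties as Allₚ
import Data.List.Relation.Unary.AllPairs.Properties as AllPairsₚ
import Data.List.Relation.Unary.Any.Properties as Anyₚ
open import Data.Vec using (Vec; []; _∷_; lookup; map; head; tail)
open import Data.Vec.Properties using (∷-injective)
open import Data.Sum using (_⊎_; inj₁; inj₂)
open import Data.Product using (_,_; proj₁; proj₂; ∃; ∃₂; map₂)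
open import Function.Base using (_∘_)
open import Function.Bundles using (Equivalence)
open import Relation.Nullary using (yes; no; ¬?; contradiction)
open import Relation.Nullary.Decidable using (isYes; toWitness; decidable-stable)
open import Relation.Binary.PropositionalEquality
-- Variable lists for the ring solver use these unambiguous names: with the overloaded _∷_ of
-- List, Vec, All and AllPairs in scope, elaborating the macro argument becomes very slow.
open import Data.List using () renaming (_∷_ to _∷ₗ_; [] to []ₗ)

-- An identity between Boolean combinations of subsets of Fin n holds iff it holds in every
-- coordinate, where it is an identity of Booleans, checked on all 2^k assignments of the k
-- variables; assignments making a hypothesis (a formula denoting ∅) true are skipped.
module SubsetSolver where

  data Formula (k : ℕ) : Set where
    var       : Fin k → Formula k
    _∪′_ _∩′_ : Formula k → Formula k → Formula k
    ∁′        : Formula k → Formula k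
    ⊤′ ⊥′     : Formula k

  infixl 6 _∪′_
  infixl 7 _∩′_

  v₀ : ∀ {k} → Formula (suc k)
  v₀ = var zero
  v₁ : ∀ {k} → Formula (suc (suc k))
  v₁ = var (suc zero)
  v₂ : ∀ {k} → Formula (suc (suc (suc k)))
  v₂ = var (suc (suc zero))
  v₃ : ∀ {k} → Formula (suc (suc (suc (suc k))))
  v₃ = var (suc (suc (suc zero)))
  v₄ : ∀ {k} → Formula (suc (suc (suc (suc (suc k)))))
  v₄ = var (suc (suc (suc (suc zero))))
  v₅ : ∀ {k} → Formula (suc (suc (suc (suc (suc (suc k))))))
  v₅ = var (suc (suc (suc (suc (suc zero)))))

  private variable
    k n : ℕ

  ⟦_⟧ᵇ : Formula k → Vec Bool k → Bool
  ⟦ var i ⟧ᵇ  β = lookup β i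
  ⟦ a ∪′ b ⟧ᵇ β = ⟦ a ⟧ᵇ β ∨ ⟦ b ⟧ᵇ β
  ⟦ a ∩′ b ⟧ᵇ β = ⟦ a ⟧ᵇ β ∧ ⟦ b ⟧ᵇ β
  ⟦ ∁′ a ⟧ᵇ   β = not (⟦ a ⟧ᵇ β)
  ⟦ ⊤′ ⟧ᵇ     β = true
  ⟦ ⊥′ ⟧ᵇ     β = false

  ⟦_⟧ : Formula k → Vec (Subset n) k → Subset n
  ⟦ var i ⟧  ρ = lookup ρ i
  ⟦ a ∪′ b ⟧ ρ = ⟦ a ⟧ ρ ∪ ⟦ b ⟧ ρ
  ⟦ a ∩′ b ⟧ ρ = ⟦ a ⟧ ρ ∩ ⟦ b ⟧ ρ
  ⟦ ∁′ a ⟧   ρ = ∁ (⟦ a ⟧ ρ)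
  ⟦ ⊤′ ⟧     ρ = ⊤
  ⟦ ⊥′ ⟧     ρ = ⊥

  every : (k : ℕ) → (Vec Bool k → Bool) → Bool
  every zero    f = f []
  every (suc k) f = every k (λ β → f (true ∷ β)) ∧ every k (λ β → f (false ∷ β))

  every-sound : ∀ k f → T (every k f) → ∀ β → T (f β)
  every-sound zero    f h [] = h
  every-sound (suc k) f h (true ∷ β)  = every-sound k _ (proj₁ (Equivalence.to T-∧ h)) β
  every-sound (suc k) f h (false ∷ β) = every-sound k _ (proj₂ (Equivalence.to T-∧ h)) β

  holdsᵇ : List (Formula k) → Formula k → Formula k → Vec Bool k → Bool
  holdsᵇ hyps lhs rhs β = any (λ c → ⟦ c ⟧ᵇ β) hyps ∨ isYes (⟦ lhs ⟧ᵇ β ≟ᵇ ⟦ rhs ⟧ᵇ β)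

  Valid : List (Formula k) → Formula k → Formula k → Set
  Valid {k} hyps lhs rhs = T (every k (holdsᵇ hyps lhs rhs))

  lookup-∷ : ∀ (i : Fin k) (ρ : Vec (Subset (suc n)) k) → lookup ρ i ≡ lookup (map head ρ) i ∷ lookup (map tail ρ) i
  lookup-∷ zero    ((b ∷ p) ∷ ρ) = refl
  lookup-∷ (suc i) (_ ∷ ρ)       = lookup-∷ i ρ

  ⟦⟧-∷ : ∀ (e : Formula k) (ρ : Vec (Subset (suc n)) k) → ⟦ e ⟧ ρ ≡ ⟦ e ⟧ᵇ (map head ρ) ∷ ⟦ e ⟧ (map tail ρ)
  ⟦⟧-∷ (var i)  ρ = lookup-∷ i ρ
  ⟦⟧-∷ (a ∪′ b) ρ rewrite ⟦⟧-∷ a ρ | ⟦⟧-∷ b ρ = refl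
  ⟦⟧-∷ (a ∩′ b) ρ rewrite ⟦⟧-∷ a ρ | ⟦⟧-∷ b ρ = refl
  ⟦⟧-∷ (∁′ a)   ρ rewrite ⟦⟧-∷ a ρ = refl
  ⟦⟧-∷ ⊤′       ρ = refl
  ⟦⟧-∷ ⊥′       ρ = refl

  Empty : Vec (Subset n) k → Formula k → Set
  Empty ρ c = ⟦ c ⟧ ρ ≡ ⊥

  any-false : ∀ (hyps : List (Formula k)) (ρ : Vec (Subset (suc n)) k) →
              All (Empty ρ) hyps → any (λ c → ⟦ c ⟧ᵇ (map head ρ)) hyps ≡ false × All (Empty (map tail ρ)) hyps
  any-false []         ρ []       = refl , []
  any-false (c ∷ hyps) ρ (h ∷ hs) with ∷-injective (trans (sym (⟦⟧-∷ c ρ)) h)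
  ... | c-false , c-tail rewrite c-false = let (f , t) = any-false hyps ρ hs in f , c-tail ∷ t

  prove : ∀ (ρ : Vec (Subset n) k) hyps lhs rhs → {Valid hyps lhs rhs} → All (Empty ρ) hyps → ⟦ lhs ⟧ ρ ≡ ⟦ rhs ⟧ ρ
  prove {zero}  ρ hyps lhs rhs        hs = trans (empty (⟦ lhs ⟧ ρ)) (sym (empty (⟦ rhs ⟧ ρ)))
    where empty : (p : Subset 0) → p ≡ []
          empty [] = refl
  prove {suc n} ρ hyps lhs rhs {valid} hs
    with every-sound _ (holdsᵇ hyps lhs rhs) valid (map head ρ) | any-false hyps ρ hs
  ... | holds | noHyp , hs′ rewrite noHyp = begin
    ⟦ lhs ⟧ ρ                                      ≡⟨ ⟦⟧-∷ lhs ρ ⟩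
    ⟦ lhs ⟧ᵇ (map head ρ) ∷ ⟦ lhs ⟧ (map tail ρ)   ≡⟨ cong₂ _∷_ head≡ (prove (map tail ρ) hyps lhs rhs {valid} hs′) ⟩
    ⟦ rhs ⟧ᵇ (map head ρ) ∷ ⟦ rhs ⟧ (map tail ρ)   ≡⟨ ⟦⟧-∷ rhs ρ ⟨
    ⟦ rhs ⟧ ρ                                      ∎
    where
    open ≡-Reasoning
    head≡ : ⟦ lhs ⟧ᵇ (map head ρ) ≡ ⟦ rhs ⟧ᵇ (map head ρ)
    head≡ = toWitness {a? = ⟦ lhs ⟧ᵇ (map head ρ) ≟ᵇ ⟦ rhs ⟧ᵇ (map head ρ)} holds

open SubsetSolver

∩∁≡⊥⇒⊆ : ∀ {n} {A B : Subset n} → A ∩ ∁ B ≡ ⊥ → A ⊆ B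
∩∁≡⊥⇒⊆ {A = A} {B} A∩∁B≡⊥ x∈A = subst (_ ∈_) A∪B≡B (p⊆p∪q B x∈A)
  where
  A∪B≡B : A ∪ B ≡ B
  A∪B≡B = prove (A ∷ B ∷ []) (v₀ ∩′ ∁′ v₁ ∷ []) (v₀ ∪′ v₁) v₁ (A∩∁B≡⊥ ∷ [])

∣∪∣≡∣∣+∣∣ : ∀ {n} (X Y : Subset n) → X ∩ Y ≡ ⊥ → ∣ X ∪ Y ∣ ≡ ∣ X ∣ + ∣ Y ∣
∣∪∣≡∣∣+∣∣ []          []          _ = refl
∣∪∣≡∣∣+∣∣ (true ∷ X)  (true ∷ Y)  ()
∣∪∣≡∣∣+∣∣ (true ∷ X)  (false ∷ Y) h = cong suc (∣∪∣≡∣∣+∣∣ X Y (proj₂ (∷-injective h)))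
∣∪∣≡∣∣+∣∣ (false ∷ X) (true ∷ Y)  h = trans (cong suc (∣∪∣≡∣∣+∣∣ X Y (proj₂ (∷-injective h)))) (sym (+-suc _ _))
∣∪∣≡∣∣+∣∣ (false ∷ X) (false ∷ Y) h = ∣∪∣≡∣∣+∣∣ X Y (proj₂ (∷-injective h))

∩-⋃≡⊥ : ∀ {n} {Y : Subset n} {Ys} → All (λ Z → Y ∩ Z ≡ ⊥) Ys → Y ∩ ⋃ Ys ≡ ⊥
∩-⋃≡⊥ {Y = Y} [] = prove (Y ∷ []) [] (v₀ ∩′ ⊥′) ⊥′ []
∩-⋃≡⊥ {Y = Y} {Z ∷ Zs} (Y∩Z≡⊥ ∷ Y∩Zs≡⊥) =
  prove (Y ∷ Z ∷ ⋃ Zs ∷ []) (v₀ ∩′ v₁ ∷ v₀ ∩′ v₂ ∷ []) (v₀ ∩′ (v₁ ∪′ v₂)) ⊥′ (Y∩Z≡⊥ ∷ ∩-⋃≡⊥ Y∩Zs≡⊥ ∷ [])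

∈-⋃⁺ : ∀ {n} {x : Fin n} {Ys} → Any (x ∈_) Ys → x ∈ ⋃ Ys
∈-⋃⁺ (here x∈Y)    = x∈p∪q⁺ (inj₁ x∈Y)
∈-⋃⁺ (there x∈⋃Ys) = x∈p∪q⁺ (inj₂ (∈-⋃⁺ x∈⋃Ys))

∈-⋃⁻ : ∀ {n} {x : Fin n} Ys → x ∈ ⋃ Ys → Any (x ∈_) Ys
∈-⋃⁻ []       x∈⊥ = contradiction x∈⊥ ∉⊥
∈-⋃⁻ (Y ∷ Ys) x∈⋃ with x∈p∪q⁻ Y (⋃ Ys) x∈⋃
... | inj₁ x∈Y   = here x∈Y
... | inj₂ x∈⋃Ys = there (∈-⋃⁻ Ys x∈⋃Ys)

⊆⇒∩∁≡⊥ : ∀ {n} {A B : Subset n} → A ⊆ B → A ∩ ∁ B ≡ ⊥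
⊆⇒∩∁≡⊥ {A = A} {B} A⊆B = ⊆-antisym (λ x∈A∩∁B → let (x∈A , x∈∁B) = x∈p∩q⁻ A (∁ B) x∈A∩∁B
                                                in contradiction (A⊆B x∈A) (x∈∁p⇒x∉p x∈∁B)) ⊥⊆

listed⇒n≤length : ∀ {n} (is : List (Fin n)) → (∀ d → d ∈ₗ is) → n ≤ length is
listed⇒n≤length is listed = ≮⇒≥ λ |is|<n →
  let (i , j , i<j , same-index) = pigeonhole |is|<n (λ d → index (listed d))
  in <-irrefl (trans (Anyₚ.lookup-index (listed i))
                     (trans (cong (lookupₗ is) same-index) (sym (Anyₚ.lookup-index (listed j))))) i<j

fresh : ∀ {n} (is : List (Fin n)) → length is < n → ∃ λ d → All (d ≢_) is
fresh is |is|<n with any? (λ d → all? (λ i → ¬? (d ≟ i)) is)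
... | yes found = found
... | no none = contradiction |is|<n (≤⇒≯ (listed⇒n≤length is listed))
  where
  listed : ∀ d → d ∈ₗ is
  listed d = mapₐ (decidable-stable (d ≟ _)) (Allₚ.¬All⇒Any¬ (λ i → ¬? (d ≟ i)) is (λ d∉is → none (d , d∉is)))

module Arithmetic where

  x+y≤a+b⇒x≤c : ∀ {x y a b c} → x + y ≤ a + b → a ≤ c → b ≤ c → c ≤ y → x ≤ c
  x+y≤a+b⇒x≤c {x} {c = c} x+y≤a+b a≤c b≤c c≤y =
    +-cancelʳ-≤ c x c (≤-trans (+-monoʳ-≤ x c≤y) (≤-trans x+y≤a+b (+-mono-≤ a≤c b≤c)))

  x+y≤z+w⇒x≤z : ∀ {x y z w} → x + y ≤ z + w → w ≤ y → x ≤ z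
  x+y≤z+w⇒x≤z {x} {y} {z} x+y≤z+w w≤y = +-cancelʳ-≤ y x z (≤-trans x+y≤z+w (+-monoʳ-≤ z w≤y))

  a+b≤x+y⇒≡ : ∀ {a b x y} → a + b ≤ x + y → x ≤ a → y ≤ b → a ≡ x × b ≡ y
  a+b≤x+y⇒≡ {a} {b} {x} {y} a+b≤x+y x≤a y≤b =
    ≤-antisym (+-cancelʳ-≤ y a x (≤-trans (+-monoʳ-≤ a y≤b) a+b≤x+y)) x≤a ,
    ≤-antisym (+-cancelˡ-≤ x b y (≤-trans (+-monoˡ-≤ b x≤a) a+b≤x+y)) y≤b

  cross-≤⇒≡ : ∀ {a b c d s} → a + d ≤ s → c + b ≤ s → s ≤ a + b → s ≤ c + d → a ≡ c × a + b ≡ s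
  cross-≤⇒≡ {a} {b} {c} {d} a+d≤s c+b≤s s≤a+b s≤c+d = a≡c , ≤-antisym (subst (λ z → z + b ≤ _) (sym a≡c) c+b≤s) s≤a+b
    where
    a≡c : a ≡ c
    a≡c = ≤-antisym (+-cancelʳ-≤ d a c (≤-trans a+d≤s s≤c+d)) (+-cancelʳ-≤ b c a (≤-trans c+b≤s s≤a+b))

  n≤1⇒n≢0⇒n≡1 : ∀ {n} → n ≤ 1 → n ≢ 0 → n ≡ 1
  n≤1⇒n≢0⇒n≡1 z≤n       n≢0 = contradiction refl n≢0
  n≤1⇒n≢0⇒n≡1 (s≤s z≤n) _   = refl

  a+b≡c+0⇒a≤c : ∀ {a b c d} → a + b ≡ c + d → d ≡ 0 → a ≤ c
  a+b≡c+0⇒a≤c {a} {b} {c} a+b≡c+d refl = ≤-trans (m≤m+n a b) (≤-reflexive (trans a+b≡c+d (+-identityʳ c)))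

  a+b≤c⇒a≤c∸b : ∀ {a b c} k → a + b ≤ c → b ≡ k → a ≤ c ∸ k
  a+b≤c⇒a≤c∸b {a} k a+b≤c refl = subst (_≤ _) (m+n∸n≡m a k) (∸-monoˡ-≤ k a+b≤c)

  a+b≡c⇒a≡c∸b : ∀ {a b c} k → a + b ≡ c → b ≡ k → a ≡ c ∸ k
  a+b≡c⇒a≡c∸b {a} k a+b≡c refl = trans (sym (m+n∸n≡m a k)) (cong (_∸ k) a+b≡c)

  a+b≡c⇒b≡c∸a : ∀ {a b c} k → a + b ≡ c → a ≡ k → b ≡ c ∸ k
  a+b≡c⇒b≡c∸a {a} {b} k a+b≡c = a+b≡c⇒a≡c∸b k (trans (+-comm b a) a+b≡c)

  complement-≤ : ∀ a a′ b b′ c c′ d d′ {k} → a + a′ ≡ k → b + b′ ≡ k → c + c′ ≡ k → d + d′ ≡ k →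
                 c′ + d′ ≤ a′ + b′ → a + b ≤ c + d
  complement-≤ a a′ b b′ c c′ d d′ ea eb ec ed le = +-cancelʳ-≤ (c′ + d′) _ _ (begin
    a + b + (c′ + d′)     ≤⟨ +-monoʳ-≤ (a + b) le ⟩
    a + b + (a′ + b′)     ≡⟨ solve (a ∷ₗ b ∷ₗ a′ ∷ₗ b′ ∷ₗ []ₗ) ⟩
    (a + a′) + (b + b′)   ≡⟨ cong₂ _+_ (trans ea (sym ec)) (trans eb (sym ed)) ⟩
    (c + c′) + (d + d′)   ≡⟨ solve (c ∷ₗ c′ ∷ₗ d ∷ₗ d′ ∷ₗ []ₗ) ⟩
    c + d + (c′ + d′)     ∎)
    where open ≤-Reasoning

  submodular-transfer : ∀ eU eW eA eB u w a b u′ w′ a′ b′ l m →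
    eU + u′ + m ≡ u + l → eW + w′ + m ≡ w + l → eA + a′ + m ≡ a + l → eB + b′ + m ≡ b + l →
    u + w ≤ a + b → a′ + b′ ≤ u′ + w′ → eU + eW ≤ eA + eB
  submodular-transfer eU eW eA eB u w a b u′ w′ a′ b′ l m eu ew ea eb sub super =
    +-cancelʳ-≤ (u′ + w′ + (m + m)) _ _ (begin
      eU + eW + (u′ + w′ + (m + m))        ≡⟨ solve (eU ∷ₗ eW ∷ₗ u′ ∷ₗ w′ ∷ₗ m ∷ₗ []ₗ) ⟩
      (eU + u′ + m) + (eW + w′ + m)        ≡⟨ cong₂ _+_ eu ew ⟩
      (u + l) + (w + l)                    ≡⟨ solve (u ∷ₗ l ∷ₗ w ∷ₗ []ₗ) ⟩
      (u + w) + (l + l)                    ≤⟨ +-monoˡ-≤ (l + l) sub ⟩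
      (a + b) + (l + l)                    ≡⟨ solve (a ∷ₗ b ∷ₗ l ∷ₗ []ₗ) ⟩
      (a + l) + (b + l)                    ≡⟨ cong₂ _+_ ea eb ⟨
      (eA + a′ + m) + (eB + b′ + m)        ≡⟨ solve (eA ∷ₗ a′ ∷ₗ m ∷ₗ eB ∷ₗ b′ ∷ₗ []ₗ) ⟩
      eA + eB + (a′ + b′ + (m + m))        ≤⟨ +-monoʳ-≤ (eA + eB) (+-monoˡ-≤ (m + m) super) ⟩
      eA + eB + (u′ + w′ + (m + m))        ∎)
    where open ≤-Reasoning

open Arithmetic

module RankCalculus (M : Matroid) where
  open Matroid M

  r-∪≤ : ∀ X Y → r (X ∪ Y) ≤ r X + r Y
  r-∪≤ X Y = ≤-trans (m≤m+n _ _) (r-submod X Y)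

  ⊓+r∪≡r+r : ∀ X Y → ⊓ M X Y + r (X ∪ Y) ≡ r X + r Y
  ⊓+r∪≡r+r X Y = m∸n+n≡m (r-∪≤ X Y)

  rM≤r+r∁ : ∀ X → rM M ≤ r X + r (∁ X)
  rM≤r+r∁ X = subst (λ Z → r Z ≤ r X + r (∁ X)) (p∪∁p≡⊤ X) (r-∪≤ X (∁ X))

  λ+rM≡r+r∁ : ∀ X → λM M X + rM M ≡ r X + r (∁ X)
  λ+rM≡r+r∁ X = m∸n+n≡m (rM≤r+r∁ X)

  r*+rM≡∣∣+r∁ : ∀ X → r* M X + rM M ≡ ∣ X ∣ + r (∁ X)
  r*+rM≡∣∣+r∁ X = m∸n+n≡m (≤-trans (rM≤r+r∁ X) (+-monoˡ-≤ _ (r-card X)))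

  r∁∪+rM≤r∁+r∁ : ∀ X Y → X ∩ Y ≡ ⊥ → r (∁ (X ∪ Y)) + rM M ≤ r (∁ X) + r (∁ Y)
  r∁∪+rM≤r∁+r∁ X Y X∩Y≡⊥ = subst₂ (λ A B → r A + r B ≤ r (∁ X) + r (∁ Y)) ∩-eq ∪-eq
                              (subst (_≤ r (∁ X) + r (∁ Y)) (+-comm (r (∁ X ∪ ∁ Y)) (r (∁ X ∩ ∁ Y)))
                                     (r-submod (∁ X) (∁ Y)))
    where
    ∩-eq : ∁ X ∩ ∁ Y ≡ ∁ (X ∪ Y)
    ∩-eq = prove (X ∷ Y ∷ []) [] (∁′ v₀ ∩′ ∁′ v₁) (∁′ (v₀ ∪′ v₁)) []
    ∪-eq : ∁ X ∪ ∁ Y ≡ ⊤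
    ∪-eq = prove (X ∷ Y ∷ []) (v₀ ∩′ v₁ ∷ []) (∁′ v₀ ∪′ ∁′ v₁) ⊤′ (X∩Y≡⊥ ∷ [])

  ⊓*+r∁∪+rM≡r∁+r∁ : ∀ X Y → X ∩ Y ≡ ⊥ → ⊓* M X Y + r (∁ (X ∪ Y)) + rM M ≡ r (∁ X) + r (∁ Y)
  ⊓*+r∁∪+rM≡r∁+r∁ X Y X∩Y≡⊥ =
    arith (r* M X) (r* M Y) (r* M (X ∪ Y)) (rM M) ∣ X ∣ ∣ Y ∣ (r (∁ X)) (r (∁ Y)) (r (∁ (X ∪ Y)))
          (r*+rM≡∣∣+r∁ X) (r*+rM≡∣∣+r∁ Y)
          (trans (r*+rM≡∣∣+r∁ (X ∪ Y)) (cong (_+ r (∁ (X ∪ Y))) (∣∪∣≡∣∣+∣∣ X Y X∩Y≡⊥)))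
          (r∁∪+rM≤r∁+r∁ X Y X∩Y≡⊥)
    where
    arith : ∀ a b c m A B x y z → a + m ≡ A + x → b + m ≡ B + y → c + m ≡ (A + B) + z → z + m ≤ x + y →
            (a + b ∸ c) + z + m ≡ x + y
    arith a b c m A B x y z ea eb ec le = +-cancelʳ-≡ (c + m) _ _ sum
      where
      c≤a+b : c ≤ a + b
      c≤a+b = +-cancelʳ-≤ (m + m) c (a + b) (begin
        c + (m + m)           ≡⟨ solve (c ∷ₗ m ∷ₗ []ₗ) ⟩
        (c + m) + m           ≡⟨ cong (_+ m) ec ⟩
        (A + B) + z + m       ≡⟨ +-assoc (A + B) z m ⟩
        (A + B) + (z + m)     ≤⟨ +-monoʳ-≤ (A + B) le ⟩
        (A + B) + (x + y)     ≡⟨ solve (A ∷ₗ B ∷ₗ x ∷ₗ y ∷ₗ []ₗ) ⟩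
        (A + x) + (B + y)     ≡⟨ cong₂ _+_ ea eb ⟨
        (a + m) + (b + m)     ≡⟨ solve (a ∷ₗ b ∷ₗ m ∷ₗ []ₗ) ⟩
        a + b + (m + m)       ∎)
        where open ≤-Reasoning
      sum : (a + b ∸ c) + z + m + (c + m) ≡ x + y + (c + m)
      sum = begin
        (a + b ∸ c) + z + m + (c + m)   ≡⟨ shuffle (a + b ∸ c) z m c ⟩
        ((a + b ∸ c) + c) + (z + m + m) ≡⟨ cong (_+ (z + m + m)) (m∸n+n≡m c≤a+b) ⟩
        a + b + (z + m + m)             ≡⟨ solve (a ∷ₗ b ∷ₗ z ∷ₗ m ∷ₗ []ₗ) ⟩
        (a + m) + (b + m) + z           ≡⟨ cong₂ (λ s t → s + t + z) ea eb ⟩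
        (A + x) + (B + y) + z           ≡⟨ solve (A ∷ₗ x ∷ₗ B ∷ₗ y ∷ₗ z ∷ₗ []ₗ) ⟩
        x + y + ((A + B) + z)           ≡⟨ cong (x + y +_) ec ⟨
        x + y + (c + m)                 ∎
        where
        open ≡-Reasoning
        shuffle : ∀ d z m c → d + z + m + (c + m) ≡ (d + c) + (z + m + m)
        shuffle d z m c = solve (d ∷ₗ z ∷ₗ m ∷ₗ c ∷ₗ []ₗ)

  ⊓-comm : ∀ X Y → ⊓ M X Y ≡ ⊓ M Y X
  ⊓-comm X Y = cong₂ _∸_ (+-comm (r X) (r Y)) (cong r (prove (X ∷ Y ∷ []) [] (v₀ ∪′ v₁) (v₁ ∪′ v₀) []))

  ⊓*-comm : ∀ X Y → ⊓* M X Y ≡ ⊓* M Y X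
  ⊓*-comm X Y = cong₂ _∸_ (+-comm (r* M X) (r* M Y)) (cong (r* M) (prove (X ∷ Y ∷ []) [] (v₀ ∪′ v₁) (v₁ ∪′ v₀) []))

  ⊓+⊓*+λ∪≡λ+λ : ∀ X Y → X ∩ Y ≡ ⊥ → ⊓ M X Y + ⊓* M X Y + λM M (X ∪ Y) ≡ λM M X + λM M Y
  ⊓+⊓*+λ∪≡λ+λ X Y X∩Y≡⊥ =
    arith _ _ _ _ _ (rM M) (r X) (r Y) (r (∁ X)) (r (∁ Y)) (r (X ∪ Y)) (r (∁ (X ∪ Y)))
          (⊓+r∪≡r+r X Y) (⊓*+r∁∪+rM≡r∁+r∁ X Y X∩Y≡⊥) (λ+rM≡r+r∁ (X ∪ Y)) (λ+rM≡r+r∁ X) (λ+rM≡r+r∁ Y)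
    where
    arith : ∀ p p* l lX lY m rX rY r∁X r∁Y r∪ r∁∪ →
            p + r∪ ≡ rX + rY → p* + r∁∪ + m ≡ r∁X + r∁Y → l + m ≡ r∪ + r∁∪ →
            lX + m ≡ rX + r∁X → lY + m ≡ rY + r∁Y → p + p* + l ≡ lX + lY
    arith p p* l lX lY m rX rY r∁X r∁Y r∪ r∁∪ e₁ e₂ e₃ e₄ e₅ =
      +-cancelʳ-≡ (r∪ + r∁∪ + m + m) _ _ (begin
        p + p* + l + (r∪ + r∁∪ + m + m)        ≡⟨ solve (p ∷ₗ p* ∷ₗ l ∷ₗ r∪ ∷ₗ r∁∪ ∷ₗ m ∷ₗ []ₗ) ⟩
        (p + r∪) + (p* + r∁∪ + m) + (l + m)    ≡⟨ cong₂ _+_ (cong₂ _+_ e₁ e₂) e₃ ⟩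
        (rX + rY) + (r∁X + r∁Y) + (r∪ + r∁∪)   ≡⟨ solve (rX ∷ₗ rY ∷ₗ r∁X ∷ₗ r∁Y ∷ₗ r∪ ∷ₗ r∁∪ ∷ₗ []ₗ) ⟩
        (rX + r∁X) + (rY + r∁Y) + (r∪ + r∁∪)   ≡⟨ cong (_+ (r∪ + r∁∪)) (cong₂ _+_ e₄ e₅) ⟨
        (lX + m) + (lY + m) + (r∪ + r∁∪)       ≡⟨ solve (lX ∷ₗ lY ∷ₗ r∪ ∷ₗ r∁∪ ∷ₗ m ∷ₗ []ₗ) ⟩
        lX + lY + (r∪ + r∁∪ + m + m)           ∎)
      where open ≡-Reasoning

  -- X ⊆ X′ is expressed as X ∩ ∁ X′ ≡ ⊥, the form consumed by the subset solver
  ⊓-monoˡ : ∀ {X X′} Y → X ∩ ∁ X′ ≡ ⊥ → ⊓ M X Y ≤ ⊓ M X′ Y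
  ⊓-monoˡ {X} {X′} Y X⊆X′ = arith _ _ (r X) (r X′) (r Y) (r (X ∪ Y)) (r (X′ ∪ Y)) (⊓+r∪≡r+r X Y) (⊓+r∪≡r+r X′ Y) submod
    where
    submod : r (X′ ∪ Y) + r X ≤ r X′ + r (X ∪ Y)
    submod = ≤-trans (+-monoʳ-≤ (r (X′ ∪ Y)) (r-mono _ _ (∩∁≡⊥⇒⊆ (prove (X ∷ X′ ∷ Y ∷ []) (v₀ ∩′ ∁′ v₁ ∷ [])
                       (v₀ ∩′ ∁′ (v₁ ∩′ (v₀ ∪′ v₂))) ⊥′ (X⊆X′ ∷ [])))))
               (subst (λ Z → r Z + r (X′ ∩ (X ∪ Y)) ≤ r X′ + r (X ∪ Y))
                      (prove (X ∷ X′ ∷ Y ∷ []) (v₀ ∩′ ∁′ v₁ ∷ []) (v₁ ∪′ (v₀ ∪′ v₂)) (v₁ ∪′ v₂) (X⊆X′ ∷ []))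
                      (r-submod X′ (X ∪ Y)))
    arith : ∀ p p′ a a′ y u u′ → p + u ≡ a + y → p′ + u′ ≡ a′ + y → u′ + a ≤ a′ + u → p ≤ p′
    arith p p′ a a′ y u u′ e e′ le = +-cancelʳ-≤ (u + u′) p p′ (begin
      p + (u + u′)      ≡⟨ solve (p ∷ₗ u ∷ₗ u′ ∷ₗ []ₗ) ⟩
      (p + u) + u′      ≡⟨ cong (_+ u′) e ⟩
      (a + y) + u′      ≡⟨ solve (a ∷ₗ y ∷ₗ u′ ∷ₗ []ₗ) ⟩
      (u′ + a) + y      ≤⟨ +-monoˡ-≤ y le ⟩
      (a′ + u) + y      ≡⟨ solve (a′ ∷ₗ u ∷ₗ y ∷ₗ []ₗ) ⟩
      (a′ + y) + u      ≡⟨ cong (_+ u) e′ ⟨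
      (p′ + u′) + u     ≡⟨ solve (p′ ∷ₗ u′ ∷ₗ u ∷ₗ []ₗ) ⟩
      p′ + (u + u′)     ∎)
      where open ≤-Reasoning

  ⊓-monoʳ : ∀ Y {X X′} → X ∩ ∁ X′ ≡ ⊥ → ⊓ M Y X ≤ ⊓ M Y X′
  ⊓-monoʳ Y {X} {X′} X⊆X′ = subst₂ _≤_ (⊓-comm X Y) (⊓-comm X′ Y) (⊓-monoˡ Y X⊆X′)

  ⊓*-monoˡ : ∀ {X X′} Y → X ∩ ∁ X′ ≡ ⊥ → X′ ∩ Y ≡ ⊥ → ⊓* M X Y ≤ ⊓* M X′ Y
  ⊓*-monoˡ {X} {X′} Y X⊆X′ X′∩Y≡⊥ =
    arith _ _ (r (∁ X)) (r (∁ X′)) (r (∁ Y)) (r (∁ (X ∪ Y))) (r (∁ (X′ ∪ Y))) (rM M)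
          (⊓*+r∁∪+rM≡r∁+r∁ X Y X∩Y≡⊥) (⊓*+r∁∪+rM≡r∁+r∁ X′ Y X′∩Y≡⊥) submod
    where
    ρ : Vec (Subset size) 3
    ρ = X ∷ X′ ∷ Y ∷ []
    X∩Y≡⊥ : X ∩ Y ≡ ⊥
    X∩Y≡⊥ = prove ρ (v₀ ∩′ ∁′ v₁ ∷ v₁ ∩′ v₂ ∷ []) (v₀ ∩′ v₂) ⊥′ (X⊆X′ ∷ X′∩Y≡⊥ ∷ [])
    submod : r (∁ X) + r (∁ (X′ ∪ Y)) ≤ r (∁ X′) + r (∁ (X ∪ Y))
    submod = subst₂ (λ A B → r A + r B ≤ r (∁ X′) + r (∁ (X ∪ Y)))
               (prove ρ (v₀ ∩′ ∁′ v₁ ∷ v₁ ∩′ v₂ ∷ []) (∁′ v₁ ∪′ ∁′ (v₀ ∪′ v₂)) (∁′ v₀) (X⊆X′ ∷ X′∩Y≡⊥ ∷ []))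
               (prove ρ (v₀ ∩′ ∁′ v₁ ∷ v₁ ∩′ v₂ ∷ []) (∁′ v₁ ∩′ ∁′ (v₀ ∪′ v₂)) (∁′ (v₁ ∪′ v₂)) (X⊆X′ ∷ X′∩Y≡⊥ ∷ []))
               (r-submod (∁ X′) (∁ (X ∪ Y)))
    arith : ∀ p p′ a a′ y u u′ m → p + u + m ≡ a + y → p′ + u′ + m ≡ a′ + y → a + u′ ≤ a′ + u → p ≤ p′
    arith p p′ a a′ y u u′ m e e′ le = +-cancelʳ-≤ (u + u′ + m) p p′ (begin
      p + (u + u′ + m)      ≡⟨ solve (p ∷ₗ u ∷ₗ u′ ∷ₗ m ∷ₗ []ₗ) ⟩
      (p + u + m) + u′      ≡⟨ cong (_+ u′) e ⟩
      (a + y) + u′          ≡⟨ solve (a ∷ₗ y ∷ₗ u′ ∷ₗ []ₗ) ⟩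
      (a + u′) + y          ≤⟨ +-monoˡ-≤ y le ⟩
      (a′ + u) + y          ≡⟨ solve (a′ ∷ₗ u ∷ₗ y ∷ₗ []ₗ) ⟩
      (a′ + y) + u          ≡⟨ cong (_+ u) e′ ⟨
      (p′ + u′ + m) + u     ≡⟨ solve (p′ ∷ₗ u′ ∷ₗ m ∷ₗ u ∷ₗ []ₗ) ⟩
      p′ + (u + u′ + m)     ∎)
      where open ≤-Reasoning

  ⊓*-monoʳ : ∀ Y {X X′} → X ∩ ∁ X′ ≡ ⊥ → X′ ∩ Y ≡ ⊥ → ⊓* M Y X ≤ ⊓* M Y X′
  ⊓*-monoʳ Y {X} {X′} X⊆X′ X′∩Y≡⊥ = subst₂ _≤_ (⊓*-comm X Y) (⊓*-comm X′ Y) (⊓*-monoˡ Y X⊆X′ X′∩Y≡⊥)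

  ⊓-∁+⊓*≡λ : ∀ X T → X ∩ T ≡ ⊥ → ⊓ M (∁ (X ∪ T)) X + ⊓* M T X ≡ λM M X
  ⊓-∁+⊓*≡λ X T X∩T≡⊥ =
    arith (⊓ M (∁ (X ∪ T)) X) (⊓* M T X) _ (rM M) (r (∁ (X ∪ T))) (r X) (r (∁ T)) (r (∁ X)) ⊓-eq ⊓*-eq (λ+rM≡r+r∁ X)
    where
    ρ : Vec (Subset size) 2
    ρ = X ∷ T ∷ []
    ⊓-eq : ⊓ M (∁ (X ∪ T)) X + r (∁ T) ≡ r (∁ (X ∪ T)) + r X
    ⊓-eq = subst (λ Z → ⊓ M (∁ (X ∪ T)) X + r Z ≡ r (∁ (X ∪ T)) + r X)
             (prove ρ (v₀ ∩′ v₁ ∷ []) (∁′ (v₀ ∪′ v₁) ∪′ v₀) (∁′ v₁) (X∩T≡⊥ ∷ []))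
             (⊓+r∪≡r+r (∁ (X ∪ T)) X)
    ⊓*-eq : ⊓* M T X + r (∁ (X ∪ T)) + rM M ≡ r (∁ T) + r (∁ X)
    ⊓*-eq = subst (λ Z → ⊓* M T X + r Z + rM M ≡ r (∁ T) + r (∁ X))
              (prove ρ [] (∁′ (v₁ ∪′ v₀)) (∁′ (v₀ ∪′ v₁)) [])
              (⊓*+r∁∪+rM≡r∁+r∁ T X (prove ρ (v₀ ∩′ v₁ ∷ []) (v₁ ∩′ v₀) ⊥′ (X∩T≡⊥ ∷ [])))
    arith : ∀ p p* l m rU rX r∁T r∁X → p + r∁T ≡ rU + rX → p* + rU + m ≡ r∁T + r∁X → l + m ≡ rX + r∁X →
            p + p* ≡ l
    arith p p* l m rU rX r∁T r∁X e₁ e₂ e₃ = +-cancelʳ-≡ (r∁T + rU + m) _ _ (begin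
      p + p* + (r∁T + rU + m)      ≡⟨ solve (p ∷ₗ p* ∷ₗ r∁T ∷ₗ rU ∷ₗ m ∷ₗ []ₗ) ⟩
      (p + r∁T) + (p* + rU + m)    ≡⟨ cong₂ _+_ e₁ e₂ ⟩
      rU + rX + (r∁T + r∁X)        ≡⟨ solve (rU ∷ₗ rX ∷ₗ r∁T ∷ₗ r∁X ∷ₗ []ₗ) ⟩
      (rX + r∁X) + (r∁T + rU)      ≡⟨ cong (_+ (r∁T + rU)) e₃ ⟨
      l + m + (r∁T + rU)           ≡⟨ solve (l ∷ₗ m ∷ₗ r∁T ∷ₗ rU ∷ₗ []ₗ) ⟩
      l + (r∁T + rU + m)           ∎)
      where open ≡-Reasoning

  ⊓*-∁+⊓≡λ : ∀ X T → X ∩ T ≡ ⊥ → ⊓* M (∁ (X ∪ T)) X + ⊓ M T X ≡ λM M X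
  ⊓*-∁+⊓≡λ X T X∩T≡⊥ =
    arith (⊓* M (∁ (X ∪ T)) X) (⊓ M T X) _ (rM M) (r T) (r X) (r (∁ X)) (r (X ∪ T)) ⊓*-eq ⊓-eq (λ+rM≡r+r∁ X)
    where
    ρ : Vec (Subset size) 2
    ρ = X ∷ T ∷ []
    ⊓*-eq : ⊓* M (∁ (X ∪ T)) X + r T + rM M ≡ r (X ∪ T) + r (∁ X)
    ⊓*-eq = subst₂ (λ Z W → ⊓* M (∁ (X ∪ T)) X + r Z + rM M ≡ r W + r (∁ X))
              (prove ρ (v₀ ∩′ v₁ ∷ []) (∁′ (∁′ (v₀ ∪′ v₁) ∪′ v₀)) v₁ (X∩T≡⊥ ∷ []))
              (prove ρ [] (∁′ (∁′ (v₀ ∪′ v₁))) (v₀ ∪′ v₁) [])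
              (⊓*+r∁∪+rM≡r∁+r∁ (∁ (X ∪ T)) X (prove ρ [] (∁′ (v₀ ∪′ v₁) ∩′ v₀) ⊥′ []))
    ⊓-eq : ⊓ M T X + r (X ∪ T) ≡ r T + r X
    ⊓-eq = subst (λ Z → ⊓ M T X + r Z ≡ r T + r X) (prove ρ [] (v₁ ∪′ v₀) (v₀ ∪′ v₁) []) (⊓+r∪≡r+r T X)
    arith : ∀ p* p l m rT rX r∁X r∪ → p* + rT + m ≡ r∪ + r∁X → p + r∪ ≡ rT + rX → l + m ≡ rX + r∁X →
            p* + p ≡ l
    arith p* p l m rT rX r∁X r∪ e₁ e₂ e₃ = +-cancelʳ-≡ (rT + m + r∪) _ _ (begin
      p* + p + (rT + m + r∪)       ≡⟨ solve (p* ∷ₗ p ∷ₗ rT ∷ₗ m ∷ₗ r∪ ∷ₗ []ₗ) ⟩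
      (p* + rT + m) + (p + r∪)     ≡⟨ cong₂ _+_ e₁ e₂ ⟩
      r∪ + r∁X + (rT + rX)         ≡⟨ solve (r∪ ∷ₗ r∁X ∷ₗ rT ∷ₗ rX ∷ₗ []ₗ) ⟩
      (rX + r∁X) + (rT + r∪)       ≡⟨ cong (_+ (rT + r∪)) e₃ ⟨
      l + m + (rT + r∪)            ≡⟨ solve (l ∷ₗ m ∷ₗ rT ∷ₗ r∪ ∷ₗ []ₗ) ⟩
      l + (rT + m + r∪)            ∎)
      where open ≡-Reasoning

  ⊓-chain : ∀ A B C → ⊓ M (A ∪ B) C + ⊓ M A B ≡ ⊓ M A C + ⊓ M B (A ∪ C)
  ⊓-chain A B C =
    arith (⊓ M (A ∪ B) C) (⊓ M A B) (⊓ M A C) (⊓ M B (A ∪ C)) (r ((A ∪ B) ∪ C)) (r (A ∪ B)) (r (A ∪ C))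
          (r A) (r B) (r C) (⊓+r∪≡r+r (A ∪ B) C) (⊓+r∪≡r+r A B) (⊓+r∪≡r+r A C)
          (subst (λ Z → ⊓ M B (A ∪ C) + r Z ≡ r B + r (A ∪ C))
                 (prove (A ∷ B ∷ C ∷ []) [] (v₁ ∪′ (v₀ ∪′ v₂)) ((v₀ ∪′ v₁) ∪′ v₂) [])
                 (⊓+r∪≡r+r B (A ∪ C)))
    where
    arith : ∀ p₁ p₂ p₃ p₄ rABC rAB rAC rA rB rC → p₁ + rABC ≡ rAB + rC → p₂ + rAB ≡ rA + rB →
            p₃ + rAC ≡ rA + rC → p₄ + rABC ≡ rB + rAC → p₁ + p₂ ≡ p₃ + p₄
    arith p₁ p₂ p₃ p₄ rABC rAB rAC rA rB rC e₁ e₂ e₃ e₄ =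
      +-cancelʳ-≡ (rABC + rAB + rAC) _ _ (begin
        p₁ + p₂ + (rABC + rAB + rAC)          ≡⟨ solve (p₁ ∷ₗ p₂ ∷ₗ rABC ∷ₗ rAB ∷ₗ rAC ∷ₗ []ₗ) ⟩
        (p₁ + rABC) + (p₂ + rAB) + rAC        ≡⟨ cong (_+ rAC) (cong₂ _+_ e₁ e₂) ⟩
        rAB + rC + (rA + rB) + rAC            ≡⟨ solve (rAB ∷ₗ rC ∷ₗ rA ∷ₗ rB ∷ₗ rAC ∷ₗ []ₗ) ⟩
        (rA + rC) + (rB + rAC) + rAB          ≡⟨ cong (_+ rAB) (cong₂ _+_ e₃ e₄) ⟨
        (p₃ + rAC) + (p₄ + rABC) + rAB        ≡⟨ solve (p₃ ∷ₗ rAC ∷ₗ p₄ ∷ₗ rABC ∷ₗ rAB ∷ₗ []ₗ) ⟩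
        p₃ + p₄ + (rABC + rAB + rAC)          ∎)
      where open ≡-Reasoning

  r∁-submod : ∀ A B → r (∁ (A ∩ B)) + r (∁ (A ∪ B)) ≤ r (∁ A) + r (∁ B)
  r∁-submod A B = subst₂ (λ Z W → r Z + r W ≤ r (∁ A) + r (∁ B))
                    (prove (A ∷ B ∷ []) [] (∁′ v₀ ∪′ ∁′ v₁) (∁′ (v₀ ∩′ v₁)) [])
                    (prove (A ∷ B ∷ []) [] (∁′ v₀ ∩′ ∁′ v₁) (∁′ (v₀ ∪′ v₁)) [])
                    (r-submod (∁ A) (∁ B))

  λ-submodular : ∀ A B → λM M (A ∪ B) + λM M (A ∩ B) ≤ λM M A + λM M B
  λ-submodular A B =
    arith (λM M (A ∪ B)) (λM M (A ∩ B)) (λM M A) (λM M B) (rM M) (r (A ∪ B)) (r (A ∩ B))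
          (r (∁ (A ∪ B))) (r (∁ (A ∩ B))) (r A) (r B) (r (∁ A)) (r (∁ B))
          (λ+rM≡r+r∁ (A ∪ B)) (λ+rM≡r+r∁ (A ∩ B)) (λ+rM≡r+r∁ A) (λ+rM≡r+r∁ B) (r-submod A B) (r∁-submod A B)
    where
    arith : ∀ l₁ l₂ la lb m x₁ x₂ y₁ y₂ a b ca cb → l₁ + m ≡ x₁ + y₁ → l₂ + m ≡ x₂ + y₂ →
            la + m ≡ a + ca → lb + m ≡ b + cb → x₁ + x₂ ≤ a + b → y₂ + y₁ ≤ ca + cb → l₁ + l₂ ≤ la + lb
    arith l₁ l₂ la lb m x₁ x₂ y₁ y₂ a b ca cb e₁ e₂ e₃ e₄ le₁ le₂ =
      +-cancelʳ-≤ (m + m) _ _ (begin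
        l₁ + l₂ + (m + m)        ≡⟨ solve (l₁ ∷ₗ l₂ ∷ₗ m ∷ₗ []ₗ) ⟩
        (l₁ + m) + (l₂ + m)      ≡⟨ cong₂ _+_ e₁ e₂ ⟩
        x₁ + y₁ + (x₂ + y₂)      ≡⟨ solve (x₁ ∷ₗ y₁ ∷ₗ x₂ ∷ₗ y₂ ∷ₗ []ₗ) ⟩
        x₁ + x₂ + (y₂ + y₁)      ≤⟨ +-mono-≤ le₁ le₂ ⟩
        a + b + (ca + cb)        ≡⟨ solve (a ∷ₗ b ∷ₗ ca ∷ₗ cb ∷ₗ []ₗ) ⟩
        (a + ca) + (b + cb)      ≡⟨ cong₂ _+_ e₃ e₄ ⟨
        (la + m) + (lb + m)      ≡⟨ solve (la ∷ₗ lb ∷ₗ m ∷ₗ []ₗ) ⟩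
        la + lb + (m + m)        ∎)
      where open ≤-Reasoning

module Separations (M : Matroid) (L R : Subset (Matroid.size M)) (L∩R≡⊥ : L ∩ R ≡ ⊥)
  (κ≥3 : ∀ Z → L ⊆ Z → Z ∩ R ≡ ⊥ → 3 ≤ λM M Z) (λL≡3 : λM M L ≡ 3) where
  open Matroid M
  open RankCalculus M

  Between : Subset size → Set
  Between Z = L ∩ ∁ Z ≡ ⊥ × Z ∩ R ≡ ⊥

  FourSep : Subset size → Set
  FourSep Z = Between Z × λM M Z ≤ 3

  Addable : Subset size → Set
  Addable Y = Y ∩ L ≡ ⊥ × FourSep (Y ∪ L)

  3≤λ : ∀ {Z} → Between Z → 3 ≤ λM M Z
  3≤λ {Z} (L⊆Z , Z∩R≡⊥) = κ≥3 Z (∩∁≡⊥⇒⊆ L⊆Z) Z∩R≡⊥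

  λ≡3 : ∀ {Z} → FourSep Z → λM M Z ≡ 3
  λ≡3 (between , λ≤3) = ≤-antisym λ≤3 (3≤λ between)

  Between-∪ : ∀ {A B} → Between A → Between B → Between (A ∪ B)
  Between-∪ {A} {B} (L⊆A , A∩R≡⊥) (_ , B∩R≡⊥) =
    prove (L ∷ A ∷ B ∷ R ∷ []) (v₀ ∩′ ∁′ v₁ ∷ []) (v₀ ∩′ ∁′ (v₁ ∪′ v₂)) ⊥′ (L⊆A ∷ []) ,
    prove (L ∷ A ∷ B ∷ R ∷ []) (v₁ ∩′ v₃ ∷ v₂ ∩′ v₃ ∷ []) ((v₁ ∪′ v₂) ∩′ v₃) ⊥′ (A∩R≡⊥ ∷ B∩R≡⊥ ∷ [])

  Between-∩ : ∀ {A B} → Between A → Between B → Between (A ∩ B)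
  Between-∩ {A} {B} (L⊆A , A∩R≡⊥) (L⊆B , _) =
    prove (L ∷ A ∷ B ∷ R ∷ []) (v₀ ∩′ ∁′ v₁ ∷ v₀ ∩′ ∁′ v₂ ∷ []) (v₀ ∩′ ∁′ (v₁ ∩′ v₂)) ⊥′ (L⊆A ∷ L⊆B ∷ []) ,
    prove (L ∷ A ∷ B ∷ R ∷ []) (v₁ ∩′ v₃ ∷ []) ((v₁ ∩′ v₂) ∩′ v₃) ⊥′ (A∩R≡⊥ ∷ [])

  FourSep-∪ : ∀ {A B} → FourSep A → FourSep B → FourSep (A ∪ B)
  FourSep-∪ {A} {B} (betweenA , λA≤3) (betweenB , λB≤3) =
    Between-∪ betweenA betweenB ,
    x+y≤a+b⇒x≤c (λ-submodular A B) λA≤3 λB≤3 (3≤λ (Between-∩ betweenA betweenB))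

  FourSep-∩ : ∀ {A B} → FourSep A → FourSep B → FourSep (A ∩ B)
  FourSep-∩ {A} {B} (betweenA , λA≤3) (betweenB , λB≤3) =
    Between-∩ betweenA betweenB ,
    x+y≤a+b⇒x≤c (subst (_≤ λM M A + λM M B) (+-comm (λM M (A ∪ B)) (λM M (A ∩ B))) (λ-submodular A B)) λA≤3 λB≤3
                (3≤λ (Between-∪ betweenA betweenB))

  FourSep-L : FourSep L
  FourSep-L = (prove (L ∷ []) [] (v₀ ∩′ ∁′ v₀) ⊥′ [] , L∩R≡⊥) , ≤-reflexive λL≡3

  Addable-∪ : ∀ {A B} → Addable A → Addable B → Addable (A ∪ B)
  Addable-∪ {A} {B} (A∩L≡⊥ , sepA) (B∩L≡⊥ , sepB) =
    prove (A ∷ B ∷ L ∷ []) (v₀ ∩′ v₂ ∷ v₁ ∩′ v₂ ∷ []) ((v₀ ∪′ v₁) ∩′ v₂) ⊥′ (A∩L≡⊥ ∷ B∩L≡⊥ ∷ []) ,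
    subst FourSep (prove (A ∷ B ∷ L ∷ []) [] ((v₀ ∪′ v₂) ∪′ (v₁ ∪′ v₂)) ((v₀ ∪′ v₁) ∪′ v₂) []) (FourSep-∪ sepA sepB)

  Addable-∩ : ∀ {A B} → Addable A → Addable B → Addable (A ∩ B)
  Addable-∩ {A} {B} (A∩L≡⊥ , sepA) (B∩L≡⊥ , sepB) =
    prove (A ∷ B ∷ L ∷ []) (v₀ ∩′ v₂ ∷ []) ((v₀ ∩′ v₁) ∩′ v₂) ⊥′ (A∩L≡⊥ ∷ []) ,
    subst FourSep (prove (A ∷ B ∷ L ∷ []) [] ((v₀ ∪′ v₂) ∩′ (v₁ ∪′ v₂)) ((v₀ ∩′ v₁) ∪′ v₂) []) (FourSep-∩ sepA sepB)

  Addable⇒∩R≡⊥ : ∀ {Y} → Addable Y → Y ∩ R ≡ ⊥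
  Addable⇒∩R≡⊥ {Y} (_ , (_ , Y∪L∩R≡⊥) , _) = prove (Y ∷ L ∷ R ∷ []) ((v₀ ∪′ v₁) ∩′ v₂ ∷ []) (v₀ ∩′ v₂) ⊥′ (Y∪L∩R≡⊥ ∷ [])

  ⊓+⊓*≡λ : ∀ {Y} → Addable Y → ⊓ M Y L + ⊓* M Y L ≡ λM M Y
  ⊓+⊓*≡λ {Y} (Y∩L≡⊥ , sepY∪L) = +-cancelʳ-≡ 3 _ _
    (subst₂ (λ s t → ⊓ M Y L + ⊓* M Y L + s ≡ λM M Y + t) (λ≡3 sepY∪L) λL≡3 (⊓+⊓*+λ∪≡λ+λ Y L Y∩L≡⊥))

  -- ≥ by monotonicity; ≤ because ⊓ + ⊓* + λ(Y ∪ G) = λ Y + λ G with λ G ≤ 3 ≤ λ(Y ∪ G)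
  ⊓-FourSep≡⊓-L : ∀ {Y G} → Addable Y → FourSep G → Y ∩ G ≡ ⊥ → ⊓ M Y G ≡ ⊓ M Y L × ⊓* M Y G ≡ ⊓* M Y L
  ⊓-FourSep≡⊓-L {Y} {G} addY@(_ , (_ , Y∪L∩R≡⊥) , _) ((L⊆G , G∩R≡⊥) , λG≤3) Y∩G≡⊥ =
    a+b≤x+y⇒≡ (x+y≤z+w⇒x≤z sum≤ (≤-trans λG≤3 (3≤λ between))) (⊓-monoʳ Y L⊆G) (⊓*-monoʳ Y L⊆G G∩Y≡⊥)
    where
    ρ : Vec (Subset size) 4
    ρ = L ∷ Y ∷ G ∷ R ∷ []
    G∩Y≡⊥ : G ∩ Y ≡ ⊥
    G∩Y≡⊥ = prove ρ (v₁ ∩′ v₂ ∷ []) (v₂ ∩′ v₁) ⊥′ (Y∩G≡⊥ ∷ [])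
    between : Between (Y ∪ G)
    between = prove ρ (v₀ ∩′ ∁′ v₂ ∷ []) (v₀ ∩′ ∁′ (v₁ ∪′ v₂)) ⊥′ (L⊆G ∷ []) ,
              prove ρ ((v₁ ∪′ v₀) ∩′ v₃ ∷ v₂ ∩′ v₃ ∷ []) ((v₁ ∪′ v₂) ∩′ v₃) ⊥′ (Y∪L∩R≡⊥ ∷ G∩R≡⊥ ∷ [])
    sum≤ : ⊓ M Y G + ⊓* M Y G + λM M (Y ∪ G) ≤ (⊓ M Y L + ⊓* M Y L) + λM M G
    sum≤ = ≤-reflexive (trans (⊓+⊓*+λ∪≡λ+λ Y G Y∩G≡⊥) (cong (_+ λM M G) (sym (⊓+⊓*≡λ addY))))

  -- On these sets r Z + r (E - Z) = 3 + r(M), so submodularity of Z ↦ r (E - Z) becomes supermodularity of r.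
  r-supermod : ∀ {X Y} → FourSep X → FourSep Y → r X + r Y ≤ r (X ∪ Y) + r (X ∩ Y)
  r-supermod {X} {Y} sepX sepY =
    complement-≤ (r X) (r (∁ X)) (r Y) (r (∁ Y)) (r (X ∪ Y)) (r (∁ (X ∪ Y))) (r (X ∩ Y)) (r (∁ (X ∩ Y)))
                 (r+r∁ sepX) (r+r∁ sepY) (r+r∁ (FourSep-∪ sepX sepY)) (r+r∁ (FourSep-∩ sepX sepY))
                 (subst (_≤ r (∁ X) + r (∁ Y)) (+-comm (r (∁ (X ∩ Y))) (r (∁ (X ∪ Y)))) (r∁-submod X Y))
    where
    r+r∁ : ∀ {Z} → FourSep Z → r Z + r (∁ Z) ≡ 3 + rM M
    r+r∁ {Z} sepZ = trans (sym (λ+rM≡r+r∁ Z)) (cong (_+ rM M) (λ≡3 sepZ))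

  r∁-supermod : ∀ {X Y} → FourSep X → FourSep Y → r (∁ X) + r (∁ Y) ≤ r (∁ (X ∪ Y)) + r (∁ (X ∩ Y))
  r∁-supermod {X} {Y} sepX sepY =
    complement-≤ (r (∁ X)) (r X) (r (∁ Y)) (r Y) (r (∁ (X ∪ Y))) (r (X ∪ Y)) (r (∁ (X ∩ Y))) (r (X ∩ Y))
                 (r∁+r sepX) (r∁+r sepY) (r∁+r (FourSep-∪ sepX sepY)) (r∁+r (FourSep-∩ sepX sepY)) (r-submod X Y)
    where
    r∁+r : ∀ {Z} → FourSep Z → r (∁ Z) + r Z ≡ 3 + rM M
    r∁+r {Z} sepZ = trans (+-comm (r (∁ Z)) (r Z)) (trans (sym (λ+rM≡r+r∁ Z)) (cong (_+ rM M) (λ≡3 sepZ)))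

  ⊓-L-submod : ∀ {A B} → Addable A → Addable B → ⊓ M (A ∪ B) L + ⊓ M (A ∩ B) L ≤ ⊓ M A L + ⊓ M B L
  ⊓-L-submod {A} {B} (_ , sepA∪L) (_ , sepB∪L) =
    submodular-transfer (⊓ M (A ∪ B) L) (⊓ M (A ∩ B) L) (⊓ M A L) (⊓ M B L) (r (A ∪ B)) (r (A ∩ B)) (r A) (r B)
                        (r ((A ∪ B) ∪ L)) (r ((A ∩ B) ∪ L)) (r (A ∪ L)) (r (B ∪ L)) (r L) 0
                        (⊓-eq (A ∪ B)) (⊓-eq (A ∩ B)) (⊓-eq A) (⊓-eq B) (r-submod A B)
      (subst₂ (λ U W → r (A ∪ L) + r (B ∪ L) ≤ r U + r W)
              (prove (A ∷ B ∷ L ∷ []) [] ((v₀ ∪′ v₂) ∪′ (v₁ ∪′ v₂)) ((v₀ ∪′ v₁) ∪′ v₂) [])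
              (prove (A ∷ B ∷ L ∷ []) [] ((v₀ ∪′ v₂) ∩′ (v₁ ∪′ v₂)) ((v₀ ∩′ v₁) ∪′ v₂) [])
              (r-supermod sepA∪L sepB∪L))
    where
    ⊓-eq : ∀ Z → ⊓ M Z L + r (Z ∪ L) + 0 ≡ r Z + r L
    ⊓-eq Z = trans (+-identityʳ _) (⊓+r∪≡r+r Z L)

  ⊓*-L-submod : ∀ {A B} → Addable A → Addable B → ⊓* M (A ∪ B) L + ⊓* M (A ∩ B) L ≤ ⊓* M A L + ⊓* M B L
  ⊓*-L-submod {A} {B} addA@(_ , sepA∪L) addB@(_ , sepB∪L) =
    submodular-transfer (⊓* M (A ∪ B) L) (⊓* M (A ∩ B) L) (⊓* M A L) (⊓* M B L) (r (∁ (A ∪ B))) (r (∁ (A ∩ B)))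
                        (r (∁ A)) (r (∁ B)) (r (∁ ((A ∪ B) ∪ L))) (r (∁ ((A ∩ B) ∪ L))) (r (∁ (A ∪ L))) (r (∁ (B ∪ L)))
                        (r (∁ L)) (rM M)
      (⊓*-eq (Addable-∪ addA addB)) (⊓*-eq (Addable-∩ addA addB)) (⊓*-eq addA) (⊓*-eq addB)
      (subst (_≤ r (∁ A) + r (∁ B)) (+-comm (r (∁ (A ∩ B))) (r (∁ (A ∪ B)))) (r∁-submod A B))
      (subst₂ (λ U W → r (∁ (A ∪ L)) + r (∁ (B ∪ L)) ≤ r (∁ U) + r (∁ W))
              (prove (A ∷ B ∷ L ∷ []) [] ((v₀ ∪′ v₂) ∪′ (v₁ ∪′ v₂)) ((v₀ ∪′ v₁) ∪′ v₂) [])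
              (prove (A ∷ B ∷ L ∷ []) [] ((v₀ ∪′ v₂) ∩′ (v₁ ∪′ v₂)) ((v₀ ∩′ v₁) ∪′ v₂) [])
              (r∁-supermod sepA∪L sepB∪L))
    where
    ⊓*-eq : ∀ {Z} → Addable Z → ⊓* M Z L + r (∁ (Z ∪ L)) + rM M ≡ r (∁ Z) + r (∁ L)
    ⊓*-eq {Z} (Z∩L≡⊥ , _) = ⊓*+r∁∪+rM≡r∁+r∁ Z L Z∩L≡⊥

  ⊓-chain-L : ∀ {U Y} → Addable U → Addable Y → U ∩ Y ≡ ⊥ → ⊓ M (U ∪ Y) L + ⊓ M U Y ≡ ⊓ M U L + ⊓ M Y L
  ⊓-chain-L {U} {Y} (U∩L≡⊥ , sepU∪L) addY@(Y∩L≡⊥ , _) U∩Y≡⊥ =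
    trans (⊓-chain U Y L) (cong (⊓ M U L +_) (proj₁ (⊓-FourSep≡⊓-L addY sepU∪L Y∩U∪L≡⊥)))
    where
    Y∩U∪L≡⊥ : Y ∩ (U ∪ L) ≡ ⊥
    Y∩U∪L≡⊥ = prove (U ∷ Y ∷ L ∷ []) (v₀ ∩′ v₁ ∷ v₁ ∩′ v₂ ∷ []) (v₁ ∩′ (v₀ ∪′ v₂)) ⊥′ (U∩Y≡⊥ ∷ Y∩L≡⊥ ∷ [])

  -- the dual chain rule follows from the primal one since ⊓ + ⊓* is λ on both sides
  ⊓*-chain-L : ∀ {U Y} → Addable U → Addable Y → U ∩ Y ≡ ⊥ → ⊓* M (U ∪ Y) L + ⊓* M U Y ≡ ⊓* M U L + ⊓* M Y L
  ⊓*-chain-L {U} {Y} addU addY U∩Y≡⊥ =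
    arith (⊓ M (U ∪ Y) L) (⊓* M (U ∪ Y) L) (⊓ M U L) (⊓* M U L) (⊓ M U Y) (⊓* M U Y) (⊓ M Y L) (⊓* M Y L)
          (λM M (U ∪ Y)) (λM M U) (λM M Y)
          (⊓+⊓*≡λ (Addable-∪ addU addY)) (⊓+⊓*≡λ addU) (⊓+⊓*+λ∪≡λ+λ U Y U∩Y≡⊥) (⊓+⊓*≡λ addY)
          (⊓-chain-L addU addY U∩Y≡⊥)
    where
    arith : ∀ e e* f f* p p* x x* l lU lY → e + e* ≡ l → f + f* ≡ lU → p + p* + l ≡ lU + lY →
            x + x* ≡ lY → e + p ≡ f + x → e* + p* ≡ f* + x*
    arith e e* f f* p p* x x* l lU lY e₁ e₂ e₃ e₄ chain = +-cancelʳ-≡ (e + p + l) _ _ (begin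
      e* + p* + (e + p + l)       ≡⟨ solve (e* ∷ₗ p* ∷ₗ e ∷ₗ p ∷ₗ l ∷ₗ []ₗ) ⟩
      (e + e*) + (p + p* + l)     ≡⟨ cong₂ _+_ e₁ e₃ ⟩
      l + (lU + lY)               ≡⟨ cong₂ (λ s t → l + (s + t)) e₂ e₄ ⟨
      l + ((f + f*) + (x + x*))   ≡⟨ solve (l ∷ₗ f ∷ₗ f* ∷ₗ x ∷ₗ x* ∷ₗ []ₗ) ⟩
      f* + x* + ((f + x) + l)     ≡⟨ cong (λ s → f* + x* + (s + l)) chain ⟨
      f* + x* + (e + p + l)       ∎)
      where open ≡-Reasoning

  ⊓-∁+⊓*≡3 : ∀ {T} → T ∩ L ≡ ⊥ → ⊓ M (∁ (L ∪ T)) L + ⊓* M T L ≡ 3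
  ⊓-∁+⊓*≡3 {T} T∩L≡⊥ = trans (⊓-∁+⊓*≡λ L T (prove (L ∷ T ∷ []) (v₁ ∩′ v₀ ∷ []) (v₀ ∩′ v₁) ⊥′ (T∩L≡⊥ ∷ []))) λL≡3

  ⊓*-∁+⊓≡3 : ∀ {T} → T ∩ L ≡ ⊥ → ⊓* M (∁ (L ∪ T)) L + ⊓ M T L ≡ 3
  ⊓*-∁+⊓≡3 {T} T∩L≡⊥ = trans (⊓*-∁+⊓≡λ L T (prove (L ∷ T ∷ []) (v₁ ∩′ v₀ ∷ []) (v₀ ∩′ v₁) ⊥′ (T∩L≡⊥ ∷ []))) λL≡3

  ⊓+⊓*≤3 : ∀ {A T} → T ∩ L ≡ ⊥ → A ∩ (L ∪ T) ≡ ⊥ → ⊓ M A L + ⊓* M T L ≤ 3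
  ⊓+⊓*≤3 {A} {T} T∩L≡⊥ A∩L∪T≡⊥ = ≤-trans (+-monoˡ-≤ _ (⊓-monoˡ L A⊆∁L∪T)) (≤-reflexive (⊓-∁+⊓*≡3 T∩L≡⊥))
    where
    A⊆∁L∪T : A ∩ ∁ (∁ (L ∪ T)) ≡ ⊥
    A⊆∁L∪T = prove (A ∷ L ∷ T ∷ []) (v₀ ∩′ (v₁ ∪′ v₂) ∷ []) (v₀ ∩′ ∁′ (∁′ (v₁ ∪′ v₂))) ⊥′ (A∩L∪T≡⊥ ∷ [])

  ⊓*+⊓≤3 : ∀ {A T} → T ∩ L ≡ ⊥ → A ∩ (L ∪ T) ≡ ⊥ → ⊓* M A L + ⊓ M T L ≤ 3
  ⊓*+⊓≤3 {A} {T} T∩L≡⊥ A∩L∪T≡⊥ =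
    ≤-trans (+-monoˡ-≤ _ (⊓*-monoˡ L A⊆∁L∪T (prove ρ [] (∁′ (v₁ ∪′ v₂) ∩′ v₁) ⊥′ [])))
            (≤-reflexive (⊓*-∁+⊓≡3 T∩L≡⊥))
    where
    ρ : Vec (Subset size) 3
    ρ = A ∷ L ∷ T ∷ []
    A⊆∁L∪T : A ∩ ∁ (∁ (L ∪ T)) ≡ ⊥
    A⊆∁L∪T = prove ρ (v₀ ∩′ (v₁ ∪′ v₂) ∷ []) (v₀ ∩′ ∁′ (∁′ (v₁ ∪′ v₂))) ⊥′ (A∩L∪T≡⊥ ∷ [])

  ⊓-opposite≡⊓-L : ∀ {Y X} → Addable Y → Y ∩ X ≡ ⊥ → FourSep (∁ (Y ∪ X)) →
                   ⊓ M Y X ≡ ⊓ M Y L × ⊓* M Y X ≡ ⊓* M Y L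
  ⊓-opposite≡⊓-L {Y} {X} addY Y∩X≡⊥ sepG =
    trans (⊓-comm Y X) (+-cancelˡ-≡ (⊓* M Y L) _ _ (begin
      ⊓* M Y L + ⊓ M X Y             ≡⟨ cong (_+ ⊓ M X Y) (trans (⊓*-comm G Y) (proj₂ G≈L)) ⟨
      ⊓* M G Y + ⊓ M X Y             ≡⟨ ⊓*-∁+⊓≡λ Y X Y∩X≡⊥ ⟩
      λM M Y                         ≡⟨ ⊓+⊓*≡λ addY ⟨
      ⊓ M Y L + ⊓* M Y L             ≡⟨ +-comm (⊓ M Y L) (⊓* M Y L) ⟩
      ⊓* M Y L + ⊓ M Y L             ∎)) ,
    trans (⊓*-comm Y X) (+-cancelˡ-≡ (⊓ M Y L) _ _ (begin
      ⊓ M Y L + ⊓* M X Y             ≡⟨ cong (_+ ⊓* M X Y) (trans (⊓-comm G Y) (proj₁ G≈L)) ⟨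
      ⊓ M G Y + ⊓* M X Y             ≡⟨ ⊓-∁+⊓*≡λ Y X Y∩X≡⊥ ⟩
      λM M Y                         ≡⟨ ⊓+⊓*≡λ addY ⟨
      ⊓ M Y L + ⊓* M Y L             ∎))
    where
    open ≡-Reasoning
    G : Subset size
    G = ∁ (Y ∪ X)
    G≈L : ⊓ M Y G ≡ ⊓ M Y L × ⊓* M Y G ≡ ⊓* M Y L
    G≈L = ⊓-FourSep≡⊓-L addY sepG (prove (Y ∷ X ∷ []) [] (v₀ ∩′ ∁′ (v₀ ∪′ v₁)) ⊥′ [])

  Addable-⋃ : ∀ {Ys} → All Addable Ys → Addable (⋃ Ys)
  Addable-⋃ [] = prove (L ∷ []) [] (⊥′ ∩′ v₀) ⊥′ [] , subst FourSep (prove (L ∷ []) [] v₀ (⊥′ ∪′ v₀) []) FourSep-L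
  Addable-⋃ (addY ∷ addYs) = Addable-∪ addY (Addable-⋃ addYs)

  module ⋃-Bound (π : Subset size → Subset size → ℕ)
    (π-chain : ∀ {U Y} → Addable U → Addable Y → U ∩ Y ≡ ⊥ → π (U ∪ Y) L + π U Y ≡ π U L + π Y L)
    (π-mono : ∀ {Y Z W} → Y ∩ (Z ∪ W) ≡ ⊥ → π Y Z ≤ π Y (Z ∪ W)) where

    ⋃-L≤ : ∀ {a} Y Ys → All Addable (Y ∷ Ys) → AllPairs (λ A B → A ∩ B ≡ ⊥) (Y ∷ Ys) →
           All (λ Z → π Z L ≤ a) (Y ∷ Ys) → AllPairs (λ A B → a ≤ π A B) (Y ∷ Ys) → π (⋃ (Y ∷ Ys)) L ≤ a
    ⋃-L≤ Y [] _ _ (πYL≤a ∷ []) _ = subst (λ Z → π Z L ≤ _) (prove (Y ∷ []) [] v₀ (v₀ ∪′ ⊥′) []) πYL≤a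
    ⋃-L≤ Y (Z ∷ Zs) (addY ∷ addZs) (disjY ∷ disjZs) (πYL≤a ∷ πZsL≤a) ((a≤πYZ ∷ _) ∷ a≤πZs) =
      x+y≤a+b⇒x≤c (≤-reflexive (π-chain addY (Addable-⋃ addZs) (∩-⋃≡⊥ disjY)))
                  πYL≤a (⋃-L≤ Z Zs addZs disjZs πZsL≤a a≤πZs) (≤-trans a≤πYZ (π-mono (∩-⋃≡⊥ disjY)))

  open ⋃-Bound (⊓ M) ⊓-chain-L (λ {Y} {Z} {W} _ → ⊓-monoʳ Y (prove (Z ∷ W ∷ []) [] (v₀ ∩′ ∁′ (v₀ ∪′ v₁)) ⊥′ []))
    public renaming (⋃-L≤ to ⊓-⋃-L≤)
  open ⋃-Bound (⊓* M) ⊓*-chain-L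
    (λ {Y} {Z} {W} Y∩Z∪W≡⊥ → ⊓*-monoʳ Y (prove (Z ∷ W ∷ []) [] (v₀ ∩′ ∁′ (v₀ ∪′ v₁)) ⊥′ [])
                                       (prove (Y ∷ Z ∷ W ∷ []) (v₀ ∩′ (v₁ ∪′ v₂) ∷ []) ((v₁ ∪′ v₂) ∩′ v₀) ⊥′
                                              (Y∩Z∪W≡⊥ ∷ [])))
    public renaming (⋃-L≤ to ⊓*-⋃-L≤)

module Flexipath (M : Matroid) (n : ℕ) (L R : Subset (Matroid.size M))
  (Q : Fin (5 + n) → Subset (Matroid.size M)) (flexi : Flexipath4c M 2 L Q R) where
  open Matroid M
  open RankCalculus M

  Step : Set
  Step = Fin (5 + n)

  partition : OrderedPartition M L Q R
  partition = proj₁ (proj₁ flexi id)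

  L∩R≡⊥ : L ∩ R ≡ ⊥
  L∩R≡⊥ = proj₁ partition

  L∩Q≡⊥ : ∀ i → L ∩ Q i ≡ ⊥
  L∩Q≡⊥ = proj₁ (proj₂ partition)

  Q∩R≡⊥ : ∀ i → Q i ∩ R ≡ ⊥
  Q∩R≡⊥ = proj₁ (proj₂ (proj₂ partition))

  Q∩Q≡⊥ : ∀ i j → i ≢ j → Q i ∩ Q j ≡ ⊥
  Q∩Q≡⊥ = proj₁ (proj₂ (proj₂ (proj₂ partition)))

  L∪⋃Q∪R≡⊤ : (L ∪ ⋃ (mapₗ Q (allFin (5 + n)))) ∪ R ≡ ⊤
  L∪⋃Q∪R≡⊤ = proj₂ (proj₂ (proj₂ (proj₂ partition)))

  Q∩L≡⊥ : ∀ i → Q i ∩ L ≡ ⊥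
  Q∩L≡⊥ i = prove (L ∷ Q i ∷ []) (v₀ ∩′ v₁ ∷ []) (v₁ ∩′ v₀) ⊥′ (L∩Q≡⊥ i ∷ [])

  λL≡3 : λM M L ≡ 3
  λL≡3 = trans (cong (λM M) (prove (L ∷ []) [] v₀ (v₀ ∪′ ⊥′) [])) (proj₂ (proj₂ (proj₁ flexi id)) 0 z≤n)

  open Separations M L R L∩R≡⊥ (proj₂ (proj₁ (proj₂ (proj₁ flexi id)))) λL≡3

  -- L ∪ Q i is the first 4-separation of the reordering that starts with Q i
  Q-addable : ∀ i → Addable (Q i)
  Q-addable i = Q∩L≡⊥ i , between , ≤-reflexive λQ∪L≡3
    where
    ρ : Vec (Subset size) 3
    ρ = L ∷ Q i ∷ R ∷ []
    between : Between (Q i ∪ L)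
    between = prove ρ [] (v₀ ∩′ ∁′ (v₁ ∪′ v₀)) ⊥′ [] ,
              prove ρ (v₁ ∩′ v₂ ∷ v₀ ∩′ v₂ ∷ []) ((v₁ ∪′ v₀) ∩′ v₂) ⊥′ (Q∩R≡⊥ i ∷ L∩R≡⊥ ∷ [])
    λQ∪L≡3 : λM M (Q i ∪ L) ≡ 3
    λQ∪L≡3 = trans (cong (λM M) (prove ρ [] (v₁ ∪′ v₀) (v₀ ∪′ (v₁ ∪′ ⊥′)) []))
                   (proj₂ (proj₂ (proj₁ flexi (transpose zero i))) 1 (s≤s z≤n))

  λQ≡2 : ∀ i → λM M (Q i) ≡ 2
  λQ≡2 = proj₁ (proj₂ flexi)

  3≤λQ∪Q : ∀ i j → i ≢ j → 3 ≤ λM M (Q i ∪ Q j)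
  3≤λQ∪Q = proj₂ (proj₂ flexi)

  x x* : Step → ℕ
  x  i = ⊓ M (Q i) L
  x* i = ⊓* M (Q i) L

  e e* : Step → Step → ℕ
  e  i j = ⊓ M (Q i ∪ Q j) L
  e* i j = ⊓* M (Q i ∪ Q j) L

  x+x*≡2 : ∀ i → x i + x* i ≡ 2
  x+x*≡2 i = trans (⊓+⊓*≡λ (Q-addable i)) (λQ≡2 i)

  e+e*≡λ : ∀ i j → e i j + e* i j ≡ λM M (Q i ∪ Q j)
  e+e*≡λ i j = ⊓+⊓*≡λ (Addable-∪ (Q-addable i) (Q-addable j))

  e-comm : ∀ i j → e i j ≡ e j i
  e-comm i j = cong (λ Z → ⊓ M Z L) (prove (Q i ∷ Q j ∷ []) [] (v₀ ∪′ v₁) (v₁ ∪′ v₀) [])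

  e+⊓≡x+x : ∀ {i j} → i ≢ j → e i j + ⊓ M (Q i) (Q j) ≡ x i + x j
  e+⊓≡x+x {i} {j} i≢j = ⊓-chain-L (Q-addable i) (Q-addable j) (Q∩Q≡⊥ i j i≢j)

  ⊓+⊓*+λ≡4 : ∀ {i j} → i ≢ j → ⊓ M (Q i) (Q j) + ⊓* M (Q i) (Q j) + λM M (Q i ∪ Q j) ≡ 4
  ⊓+⊓*+λ≡4 {i} {j} i≢j = trans (⊓+⊓*+λ∪≡λ+λ (Q i) (Q j) (Q∩Q≡⊥ i j i≢j)) (cong₂ _+_ (λQ≡2 i) (λQ≡2 j))

  Q⊆Q∪Q : ∀ i j → Q i ∩ ∁ (Q i ∪ Q j) ≡ ⊥
  Q⊆Q∪Q i j = prove (Q i ∷ Q j ∷ []) [] (v₀ ∩′ ∁′ (v₀ ∪′ v₁)) ⊥′ []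

  x≤e : ∀ i j → x i ≤ e i j
  x≤e i j = ⊓-monoˡ L (Q⊆Q∪Q i j)

  x*≤e* : ∀ i j → x* i ≤ e* i j
  x*≤e* i j = ⊓*-monoˡ L (Q⊆Q∪Q i j) (proj₁ (Addable-∪ (Q-addable i) (Q-addable j)))

  e+e*≤3 : ∀ {i j k l} → i ≢ k → i ≢ l → j ≢ k → j ≢ l → e i j + e* k l ≤ 3
  e+e*≤3 {i} {j} {k} {l} i≢k i≢l j≢k j≢l =
    ⊓+⊓*≤3 (proj₁ (Addable-∪ (Q-addable k) (Q-addable l)))
           (prove (L ∷ Q i ∷ Q j ∷ Q k ∷ Q l ∷ [])
                  (v₁ ∩′ v₀ ∷ v₂ ∩′ v₀ ∷ v₁ ∩′ v₃ ∷ v₁ ∩′ v₄ ∷ v₂ ∩′ v₃ ∷ v₂ ∩′ v₄ ∷ [])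
                  ((v₁ ∪′ v₂) ∩′ (v₀ ∪′ (v₃ ∪′ v₄))) ⊥′
                  (Q∩L≡⊥ i ∷ Q∩L≡⊥ j ∷ Q∩Q≡⊥ i k i≢k ∷ Q∩Q≡⊥ i l i≢l ∷ Q∩Q≡⊥ j k j≢k ∷ Q∩Q≡⊥ j l j≢l ∷ []))

  -- e + e* ≤ 3 across the two disjoint pairs (in both orders), against e + e* = λ ≥ 3 within each pair
  e≡e×λ≡3 : ∀ {i j k l} → i ≢ j → i ≢ k → i ≢ l → j ≢ k → j ≢ l → k ≢ l →
            e i j ≡ e k l × λM M (Q i ∪ Q j) ≡ 3
  e≡e×λ≡3 {i} {j} {k} {l} i≢j i≢k i≢l j≢k j≢l k≢l =
    map₂ (trans (sym (e+e*≡λ i j)))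
      (cross-≤⇒≡ (e+e*≤3 i≢k i≢l j≢k j≢l) (e+e*≤3 (≢-sym i≢k) (≢-sym j≢k) (≢-sym i≢l) (≢-sym j≢l))
                 (subst (3 ≤_) (sym (e+e*≡λ i j)) (3≤λQ∪Q i j i≢j))
                 (subst (3 ≤_) (sym (e+e*≡λ k l)) (3≤λQ∪Q k l k≢l)))

  4<5+n : 4 < 5 + n
  4<5+n = s≤s (s≤s (s≤s (s≤s (s≤s z≤n))))

  fresh₂ : ∀ (is : List Step) → length is ≤ 3 → ∃₂ λ a b → a ≢ b × All (a ≢_) is × All (b ≢_) is
  fresh₂ is |is|≤3 with fresh is (≤-<-trans (m≤n⇒m≤1+n |is|≤3) 4<5+n)
  ... | a , a∉is with fresh (a ∷ is) (≤-<-trans (s≤s |is|≤3) 4<5+n)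
  ...   | b , (b≢a ∷ b∉is) = a , b , ≢-sym b≢a , a∉is , b∉is

  e-shared : ∀ {i j l} → i ≢ j → i ≢ l → e i j ≡ e i l
  e-shared {i} {j} {l} i≢j i≢l with fresh₂ (i ∷ j ∷ l ∷ []) (s≤s (s≤s (s≤s z≤n)))
  ... | a , b , a≢b , (a≢i ∷ a≢j ∷ a≢l ∷ []) , (b≢i ∷ b≢j ∷ b≢l ∷ []) =
    trans (proj₁ (e≡e×λ≡3 i≢j (≢-sym a≢i) (≢-sym b≢i) (≢-sym a≢j) (≢-sym b≢j) a≢b))
          (sym (proj₁ (e≡e×λ≡3 i≢l (≢-sym a≢i) (≢-sym b≢i) (≢-sym a≢l) (≢-sym b≢l) a≢b)))

  e-const : ∀ {i j k l} → i ≢ j → k ≢ l → e i j ≡ e k l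
  e-const {i} {j} {k} {l} i≢j k≢l with i ≟ l
  ... | yes refl = trans (e-shared i≢j (≢-sym k≢l)) (e-comm i k)
  ... | no i≢l = begin
    e i j  ≡⟨ e-shared i≢j i≢l ⟩
    e i l  ≡⟨ e-comm i l ⟩
    e l i  ≡⟨ e-shared (≢-sym i≢l) (≢-sym k≢l) ⟩
    e l k  ≡⟨ e-comm l k ⟩
    e k l  ∎
    where open ≡-Reasoning

  α : ℕ
  α = e zero (suc zero)

  e≡α : ∀ {i j} → i ≢ j → e i j ≡ α
  e≡α i≢j = e-const i≢j (λ ())

  λQ∪Q≡3 : ∀ {i j} → i ≢ j → λM M (Q i ∪ Q j) ≡ 3
  λQ∪Q≡3 {i} {j} i≢j with fresh₂ (i ∷ j ∷ []) (s≤s (s≤s z≤n))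
  ... | a , b , a≢b , (a≢i ∷ a≢j ∷ []) , (b≢i ∷ b≢j ∷ []) =
    proj₂ (e≡e×λ≡3 i≢j (≢-sym a≢i) (≢-sym b≢i) (≢-sym a≢j) (≢-sym b≢j) a≢b)

  α+e*≡3 : ∀ {i j} → i ≢ j → α + e* i j ≡ 3
  α+e*≡3 {i} {j} i≢j = trans (cong (_+ e* i j) (sym (e≡α i≢j))) (trans (e+e*≡λ i j) (λQ∪Q≡3 i≢j))

  α+⊓≡x+x : ∀ {i j} → i ≢ j → α + ⊓ M (Q i) (Q j) ≡ x i + x j
  α+⊓≡x+x {i} {j} i≢j = trans (cong (_+ ⊓ M (Q i) (Q j)) (sym (e≡α i≢j))) (e+⊓≡x+x i≢j)

  ⊓+⊓*≡1 : ∀ {i j} → i ≢ j → ⊓ M (Q i) (Q j) + ⊓* M (Q i) (Q j) ≡ 1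
  ⊓+⊓*≡1 {i} {j} i≢j = +-cancelʳ-≡ 3 _ _ (subst (λ z → ⊓ M (Q i) (Q j) + ⊓* M (Q i) (Q j) + z ≡ 4)
                                                 (λQ∪Q≡3 i≢j) (⊓+⊓*+λ≡4 i≢j))

  other : Step → Step
  other i = punchIn i zero

  ≢other : ∀ i → i ≢ other i
  ≢other i = ≢-sym (punchInᵢ≢i i zero)

  x≤α : ∀ i → x i ≤ α
  x≤α i = subst (x i ≤_) (e≡α (≢other i)) (x≤e i (other i))

  α+x*≤3 : ∀ i → α + x* i ≤ 3
  α+x*≤3 i = subst (α + x* i ≤_) (α+e*≡3 (≢other i)) (+-monoʳ-≤ α (x*≤e* i (other i)))

  steps : ∀ {t} → (Fin t → Step) → List (Subset size)
  steps f = tabulate (λ j → Q (f j))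

  steps-addable : ∀ {t} (f : Fin t → Step) → All Addable (steps f)
  steps-addable f = Allₚ.tabulate⁺ (λ j → Q-addable (f j))

  steps-disjoint : ∀ {t} (f : Fin t → Step) → (∀ {i j} → i ≢ j → f i ≢ f j) →
                   AllPairs (λ A B → A ∩ B ≡ ⊥) (steps f)
  steps-disjoint f f-inj = AllPairsₚ.tabulate⁺ (λ i≢j → Q∩Q≡⊥ _ _ (f-inj i≢j))

  O : Subset size
  O = ∁ (L ∪ R)

  S : Step → Subset size
  S m = ∁ ((L ∪ R) ∪ Q m)

  ⋃steps≡O : ⋃ (steps (λ i → i)) ≡ O
  ⋃steps≡O = prove (L ∷ R ∷ U ∷ []) (∁′ ((v₀ ∪′ v₂) ∪′ v₁) ∷ v₂ ∩′ v₀ ∷ v₂ ∩′ v₁ ∷ []) v₂ (∁′ (v₀ ∪′ v₁))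
                   (∁L∪U∪R≡⊥ ∷ proj₁ addU ∷ Addable⇒∩R≡⊥ addU ∷ [])
    where
    U : Subset size
    U = ⋃ (steps (λ i → i))
    addU : Addable U
    addU = Addable-⋃ (steps-addable (λ i → i))
    ∁L∪U∪R≡⊥ : ∁ ((L ∪ U) ∪ R) ≡ ⊥
    ∁L∪U∪R≡⊥ = trans (cong (λ Z → ∁ ((L ∪ ⋃ Z) ∪ R)) (sym (map-tabulate (λ i → i) Q)))
                     (trans (cong ∁ L∪⋃Q∪R≡⊤) (prove [] [] (∁′ ⊤′) ⊥′ []))

  O⊆Q∪⋃steps : ∀ m → O ⊆ Q m ∪ ⋃ (steps (punchIn m))
  O⊆Q∪⋃steps m x∈O with Anyₚ.tabulate⁻ (∈-⋃⁻ (steps (λ i → i)) (subst (_ ∈_) (sym ⋃steps≡O) x∈O))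
  ... | j , x∈Qj with m ≟ j
  ...   | yes refl = x∈p∪q⁺ (inj₁ x∈Qj)
  ...   | no m≢j   = x∈p∪q⁺ (inj₂ (∈-⋃⁺ (Anyₚ.tabulate⁺ {f = λ j → Q (punchIn m j)} (punchOut m≢j)
                       (subst (λ i → _ ∈ Q i) (sym (punchIn-punchOut m≢j)) x∈Qj))))

  ⋃steps≡S : ∀ m → ⋃ (steps (punchIn m)) ≡ S m
  ⋃steps≡S m = prove (L ∷ R ∷ Q m ∷ U ∷ []) (∁′ (v₀ ∪′ v₁) ∩′ ∁′ (v₂ ∪′ v₃) ∷ v₃ ∩′ v₀ ∷ v₃ ∩′ v₁ ∷ v₂ ∩′ v₃ ∷ [])
                     v₃ (∁′ ((v₀ ∪′ v₁) ∪′ v₂))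
                     (⊆⇒∩∁≡⊥ (O⊆Q∪⋃steps m) ∷ proj₁ addU ∷ Addable⇒∩R≡⊥ addU ∷ Q∩U≡⊥ ∷ [])
    where
    U : Subset size
    U = ⋃ (steps (punchIn m))
    addU : Addable U
    addU = Addable-⋃ (steps-addable (punchIn m))
    Q∩U≡⊥ : Q m ∩ U ≡ ⊥
    Q∩U≡⊥ = ∩-⋃≡⊥ (Allₚ.tabulate⁺ (λ j → Q∩Q≡⊥ m (punchIn m j) (≢-sym (punchInᵢ≢i m j))))

  O-addable : Addable O
  O-addable = subst Addable ⋃steps≡O (Addable-⋃ (steps-addable (λ i → i)))

  S-addable : ∀ m → Addable (S m)
  S-addable m = subst Addable (⋃steps≡S m) (Addable-⋃ (steps-addable (punchIn m)))

  ⊓L+⊓*≡3 : ∀ {T X} → T ∩ L ≡ ⊥ → ∁ (L ∪ T) ≡ X → ⊓ M L X + ⊓* M T L ≡ 3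
  ⊓L+⊓*≡3 {T} T∩L≡⊥ refl = trans (cong (_+ ⊓* M T L) (⊓-comm L _)) (⊓-∁+⊓*≡3 T∩L≡⊥)

  ⊓*L+⊓≡3 : ∀ {T X} → T ∩ L ≡ ⊥ → ∁ (L ∪ T) ≡ X → ⊓* M L X + ⊓ M T L ≡ 3
  ⊓*L+⊓≡3 {T} T∩L≡⊥ refl = trans (cong (_+ ⊓ M T L) (⊓*-comm L _)) (⊓*-∁+⊓≡3 T∩L≡⊥)

  ∁L∪O≡R : ∁ (L ∪ O) ≡ R
  ∁L∪O≡R = prove (L ∷ R ∷ []) (v₀ ∩′ v₁ ∷ []) (∁′ (v₀ ∪′ ∁′ (v₀ ∪′ v₁))) v₁ (L∩R≡⊥ ∷ [])

  ∁L∪S≡Q∪R : ∀ m → ∁ (L ∪ S m) ≡ Q m ∪ R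
  ∁L∪S≡Q∪R m = prove (L ∷ R ∷ Q m ∷ []) (v₀ ∩′ v₁ ∷ v₀ ∩′ v₂ ∷ []) (∁′ (v₀ ∪′ ∁′ ((v₀ ∪′ v₁) ∪′ v₂))) (v₂ ∪′ v₁)
                     (L∩R≡⊥ ∷ L∩Q≡⊥ m ∷ [])

  ⊓LR+⊓*O≡3 : ⊓ M L R + ⊓* M O L ≡ 3
  ⊓LR+⊓*O≡3 = ⊓L+⊓*≡3 (proj₁ O-addable) ∁L∪O≡R

  ⊓*LR+⊓O≡3 : ⊓* M L R + ⊓ M O L ≡ 3
  ⊓*LR+⊓O≡3 = ⊓*L+⊓≡3 (proj₁ O-addable) ∁L∪O≡R

  ⊓LQR+⊓*S≡3 : ∀ m → ⊓ M L (Q m ∪ R) + ⊓* M (S m) L ≡ 3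
  ⊓LQR+⊓*S≡3 m = ⊓L+⊓*≡3 (proj₁ (S-addable m)) (∁L∪S≡Q∪R m)

  ⊓*LQR+⊓S≡3 : ∀ m → ⊓* M L (Q m ∪ R) + ⊓ M (S m) L ≡ 3
  ⊓*LQR+⊓S≡3 m = ⊓*L+⊓≡3 (proj₁ (S-addable m)) (∁L∪S≡Q∪R m)

  Q∪Q⊆O : ∀ i j → (Q i ∪ Q j) ∩ ∁ O ≡ ⊥
  Q∪Q⊆O i j = prove (L ∷ R ∷ Q i ∷ Q j ∷ []) (v₂ ∩′ v₀ ∷ v₃ ∩′ v₀ ∷ v₂ ∩′ v₁ ∷ v₃ ∩′ v₁ ∷ [])
                    ((v₂ ∪′ v₃) ∩′ ∁′ (∁′ (v₀ ∪′ v₁))) ⊥′ (Q∩L≡⊥ i ∷ Q∩L≡⊥ j ∷ Q∩R≡⊥ i ∷ Q∩R≡⊥ j ∷ [])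

  e≤⊓O : ∀ i j → e i j ≤ ⊓ M O L
  e≤⊓O i j = ⊓-monoˡ L (Q∪Q⊆O i j)

  e*≤⊓*O : ∀ i j → e* i j ≤ ⊓* M O L
  e*≤⊓*O i j = ⊓*-monoˡ L (Q∪Q⊆O i j) (proj₁ O-addable)

  Q∪Q⊆S : ∀ {m i j} → i ≢ m → j ≢ m → (Q i ∪ Q j) ∩ ∁ (S m) ≡ ⊥
  Q∪Q⊆S {m} {i} {j} i≢m j≢m =
    prove (L ∷ R ∷ Q i ∷ Q j ∷ Q m ∷ []) (v₂ ∩′ v₀ ∷ v₃ ∩′ v₀ ∷ v₂ ∩′ v₁ ∷ v₃ ∩′ v₁ ∷ v₂ ∩′ v₄ ∷ v₃ ∩′ v₄ ∷ [])
          ((v₂ ∪′ v₃) ∩′ ∁′ (∁′ ((v₀ ∪′ v₁) ∪′ v₄))) ⊥′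
          (Q∩L≡⊥ i ∷ Q∩L≡⊥ j ∷ Q∩R≡⊥ i ∷ Q∩R≡⊥ j ∷ Q∩Q≡⊥ i m i≢m ∷ Q∩Q≡⊥ j m j≢m ∷ [])

  e≤⊓S : ∀ {m i j} → i ≢ m → j ≢ m → e i j ≤ ⊓ M (S m) L
  e≤⊓S i≢m j≢m = ⊓-monoˡ L (Q∪Q⊆S i≢m j≢m)

  e*≤⊓*S : ∀ {m i j} → i ≢ m → j ≢ m → e* i j ≤ ⊓* M (S m) L
  e*≤⊓*S {m} i≢m j≢m = ⊓*-monoˡ L (Q∪Q⊆S i≢m j≢m) (proj₁ (S-addable m))

  S⊆O : ∀ m → S m ∩ ∁ O ≡ ⊥
  S⊆O m = prove (L ∷ R ∷ Q m ∷ []) [] (∁′ ((v₀ ∪′ v₁) ∪′ v₂) ∩′ ∁′ (∁′ (v₀ ∪′ v₁))) ⊥′ []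

  ⊓*S≤⊓*O : ∀ m → ⊓* M (S m) L ≤ ⊓* M O L
  ⊓*S≤⊓*O m = ⊓*-monoˡ L (S⊆O m) (proj₁ O-addable)

  ⊓S≤⊓O : ∀ m → ⊓ M (S m) L ≤ ⊓ M O L
  ⊓S≤⊓O m = ⊓-monoˡ L (S⊆O m)

  S∩L∪Q≡⊥ : ∀ m → S m ∩ (L ∪ Q m) ≡ ⊥
  S∩L∪Q≡⊥ m = prove (L ∷ R ∷ Q m ∷ []) [] (∁′ ((v₀ ∪′ v₁) ∪′ v₂) ∩′ (v₀ ∪′ v₂)) ⊥′ []

  ⊓S+x*≤3 : ∀ m → ⊓ M (S m) L + x* m ≤ 3
  ⊓S+x*≤3 m = ⊓+⊓*≤3 (Q∩L≡⊥ m) (S∩L∪Q≡⊥ m)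

  ⊓*S+x≤3 : ∀ m → ⊓* M (S m) L + x m ≤ 3
  ⊓*S+x≤3 m = ⊓*+⊓≤3 (Q∩L≡⊥ m) (S∩L∪Q≡⊥ m)

  S∪Q≡O : ∀ m → S m ∪ Q m ≡ O
  S∪Q≡O m = prove (L ∷ R ∷ Q m ∷ []) (v₂ ∩′ v₀ ∷ v₂ ∩′ v₁ ∷ []) (∁′ ((v₀ ∪′ v₁) ∪′ v₂) ∪′ v₂) (∁′ (v₀ ∪′ v₁))
                  (Q∩L≡⊥ m ∷ Q∩R≡⊥ m ∷ [])

  S∩Q≡⊥ : ∀ m → S m ∩ Q m ≡ ⊥
  S∩Q≡⊥ m = prove (L ∷ R ∷ Q m ∷ []) [] (∁′ ((v₀ ∪′ v₁) ∪′ v₂) ∩′ v₂) ⊥′ []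

  ⊓O+⊓SQ≡⊓S+x : ∀ m → ⊓ M O L + ⊓ M (S m) (Q m) ≡ ⊓ M (S m) L + x m
  ⊓O+⊓SQ≡⊓S+x m = subst (λ Z → ⊓ M Z L + ⊓ M (S m) (Q m) ≡ ⊓ M (S m) L + x m) (S∪Q≡O m)
                        (⊓-chain-L (S-addable m) (Q-addable m) (S∩Q≡⊥ m))

  ⊓*O+⊓*SQ≡⊓*S+x* : ∀ m → ⊓* M O L + ⊓* M (S m) (Q m) ≡ ⊓* M (S m) L + x* m
  ⊓*O+⊓*SQ≡⊓*S+x* m = subst (λ Z → ⊓* M Z L + ⊓* M (S m) (Q m) ≡ ⊓* M (S m) L + x* m) (S∪Q≡O m)
                            (⊓*-chain-L (S-addable m) (Q-addable m) (S∩Q≡⊥ m))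

  ⊓⋃steps≤ : ∀ {t c} (f : Fin (suc t) → Step) → (∀ {i j} → i ≢ j → f i ≢ f j) → (∀ j → x (f j) ≡ c) →
             (∀ {i j} → i ≢ j → c ≤ ⊓ M (Q (f i)) (Q (f j))) → ⊓ M (⋃ (steps f)) L ≤ c
  ⊓⋃steps≤ f f-inj x≡c c≤⊓ = ⊓-⋃-L≤ _ _ (steps-addable f) (steps-disjoint f f-inj)
                                    (Allₚ.tabulate⁺ (λ j → ≤-reflexive (x≡c j))) (AllPairsₚ.tabulate⁺ c≤⊓)

  ⊓*⋃steps≤ : ∀ {t c} (f : Fin (suc t) → Step) → (∀ {i j} → i ≢ j → f i ≢ f j) → (∀ j → x* (f j) ≡ c) →
              (∀ {i j} → i ≢ j → c ≤ ⊓* M (Q (f i)) (Q (f j))) → ⊓* M (⋃ (steps f)) L ≤ c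
  ⊓*⋃steps≤ f f-inj x*≡c c≤⊓* = ⊓*-⋃-L≤ _ _ (steps-addable f) (steps-disjoint f f-inj)
                                       (Allₚ.tabulate⁺ (λ j → ≤-reflexive (x*≡c j))) (AllPairsₚ.tabulate⁺ c≤⊓*)

  punchIn-≢ : ∀ (m : Step) {i j : Fin (4 + n)} → i ≢ j → punchIn m i ≢ punchIn m j
  punchIn-≢ m i≢j = i≢j ∘ punchIn-injective m _ _

  ⊓O≤ : ∀ {c} → (∀ i → x i ≡ c) → (∀ {i j} → i ≢ j → c ≤ ⊓ M (Q i) (Q j)) → ⊓ M O L ≤ c
  ⊓O≤ x≡c c≤⊓ = subst (λ Z → ⊓ M Z L ≤ _) ⋃steps≡O (⊓⋃steps≤ (λ i → i) (λ i≢j → i≢j) x≡c c≤⊓)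

  ⊓*O≤ : ∀ {c} → (∀ i → x* i ≡ c) → (∀ {i j} → i ≢ j → c ≤ ⊓* M (Q i) (Q j)) → ⊓* M O L ≤ c
  ⊓*O≤ x*≡c c≤⊓* = subst (λ Z → ⊓* M Z L ≤ _) ⋃steps≡O (⊓*⋃steps≤ (λ i → i) (λ i≢j → i≢j) x*≡c c≤⊓*)

  ⊓S≤ : ∀ {c} m → (∀ j → x (punchIn m j) ≡ c) → (∀ {i j} → i ≢ j → c ≤ ⊓ M (Q (punchIn m i)) (Q (punchIn m j))) →
        ⊓ M (S m) L ≤ c
  ⊓S≤ m x≡c c≤⊓ = subst (λ Z → ⊓ M Z L ≤ _) (⋃steps≡S m) (⊓⋃steps≤ (punchIn m) (punchIn-≢ m) x≡c c≤⊓)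

  ⊓*S≤ : ∀ {c} m → (∀ j → x* (punchIn m j) ≡ c) → (∀ {i j} → i ≢ j → c ≤ ⊓* M (Q (punchIn m i)) (Q (punchIn m j))) →
         ⊓* M (S m) L ≤ c
  ⊓*S≤ m x*≡c c≤⊓* = subst (λ Z → ⊓* M Z L ≤ _) (⋃steps≡S m) (⊓*⋃steps≤ (punchIn m) (punchIn-≢ m) x*≡c c≤⊓*)

  α≤⊓S∩S×3≤α+⊓*S∩S : ∀ a b → α ≤ ⊓ M (S a ∩ S b) L × 3 ≤ α + ⊓* M (S a ∩ S b) L
  α≤⊓S∩S×3≤α+⊓*S∩S a b with fresh₂ (a ∷ b ∷ []) (s≤s (s≤s z≤n))
  ... | c , d , c≢d , (c≢a ∷ c≢b ∷ []) , (d≢a ∷ d≢b ∷ []) =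
    subst (_≤ ⊓ M (S a ∩ S b) L) (e≡α c≢d) (⊓-monoˡ L Q∪Q⊆S∩S) ,
    subst (_≤ α + ⊓* M (S a ∩ S b) L) (α+e*≡3 c≢d)
          (+-monoʳ-≤ α (⊓*-monoˡ L Q∪Q⊆S∩S (proj₁ (Addable-∩ (S-addable a) (S-addable b)))))
    where
    Q∪Q⊆S∩S : (Q c ∪ Q d) ∩ ∁ (S a ∩ S b) ≡ ⊥
    Q∪Q⊆S∩S = prove (L ∷ R ∷ Q a ∷ Q b ∷ Q c ∷ Q d ∷ [])
                    (v₄ ∩′ v₀ ∷ v₅ ∩′ v₀ ∷ v₄ ∩′ v₁ ∷ v₅ ∩′ v₁ ∷ v₄ ∩′ v₂ ∷ v₄ ∩′ v₃ ∷ v₅ ∩′ v₂ ∷ v₅ ∩′ v₃ ∷ [])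
                    ((v₄ ∪′ v₅) ∩′ ∁′ (∁′ ((v₀ ∪′ v₁) ∪′ v₂) ∩′ ∁′ ((v₀ ∪′ v₁) ∪′ v₃))) ⊥′
                    (Q∩L≡⊥ c ∷ Q∩L≡⊥ d ∷ Q∩R≡⊥ c ∷ Q∩R≡⊥ d ∷
                     Q∩Q≡⊥ c a c≢a ∷ Q∩Q≡⊥ c b c≢b ∷ Q∩Q≡⊥ d a d≢a ∷ Q∩Q≡⊥ d b d≢b ∷ [])

  S∪S≡O : ∀ {a b} → a ≢ b → S a ∪ S b ≡ O
  S∪S≡O {a} {b} a≢b = prove (L ∷ R ∷ Q a ∷ Q b ∷ []) (v₂ ∩′ v₃ ∷ [])
                            (∁′ ((v₀ ∪′ v₁) ∪′ v₂) ∪′ ∁′ ((v₀ ∪′ v₁) ∪′ v₃)) (∁′ (v₀ ∪′ v₁)) (Q∩Q≡⊥ a b a≢b ∷ [])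

  ⊓O+⊓S∩S≤⊓S+⊓S : ∀ {a b} → a ≢ b → ⊓ M O L + ⊓ M (S a ∩ S b) L ≤ ⊓ M (S a) L + ⊓ M (S b) L
  ⊓O+⊓S∩S≤⊓S+⊓S {a} {b} a≢b = subst (λ Z → ⊓ M Z L + ⊓ M (S a ∩ S b) L ≤ ⊓ M (S a) L + ⊓ M (S b) L)
                                     (S∪S≡O a≢b) (⊓-L-submod (S-addable a) (S-addable b))

  ⊓*O+⊓*S∩S≤⊓*S+⊓*S : ∀ {a b} → a ≢ b → ⊓* M O L + ⊓* M (S a ∩ S b) L ≤ ⊓* M (S a) L + ⊓* M (S b) L
  ⊓*O+⊓*S∩S≤⊓*S+⊓*S {a} {b} a≢b = subst (λ Z → ⊓* M Z L + ⊓* M (S a ∩ S b) L ≤ ⊓* M (S a) L + ⊓* M (S b) L)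
                                         (S∪S≡O a≢b) (⊓*-L-submod (S-addable a) (S-addable b))

  ⊓O≤2 : α ≡ 2 → ∀ {a b} → a ≢ b → x* a ≡ 1 → x* b ≡ 1 → ⊓ M O L ≤ 2
  ⊓O≤2 α≡2 {a} {b} a≢b x*a≡1 x*b≡1 =
    x+y≤a+b⇒x≤c (⊓O+⊓S∩S≤⊓S+⊓S a≢b) (a+b≤c⇒a≤c∸b 1 (⊓S+x*≤3 a) x*a≡1) (a+b≤c⇒a≤c∸b 1 (⊓S+x*≤3 b) x*b≡1)
                (subst (_≤ ⊓ M (S a ∩ S b) L) α≡2 (proj₁ (α≤⊓S∩S×3≤α+⊓*S∩S a b)))

  ⊓*O≤2 : α ≡ 1 → ∀ {a b} → a ≢ b → x a ≡ 1 → x b ≡ 1 → ⊓* M O L ≤ 2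
  ⊓*O≤2 α≡1 {a} {b} a≢b xa≡1 xb≡1 =
    x+y≤a+b⇒x≤c (⊓*O+⊓*S∩S≤⊓*S+⊓*S a≢b) (a+b≤c⇒a≤c∸b 1 (⊓*S+x≤3 a) xa≡1) (a+b≤c⇒a≤c∸b 1 (⊓*S+x≤3 b) xb≡1)
                (+-cancelˡ-≤ 1 2 (⊓* M (S a ∩ S b) L)
                             (subst (λ z → 3 ≤ z + ⊓* M (S a ∩ S b) L) α≡1 (proj₂ (α≤⊓S∩S×3≤α+⊓*S∩S a b))))

  ⊓QQ≡ : ∀ {a c i j} → α ≡ a → i ≢ j → x i ≡ c → x j ≡ c →
         ⊓ M (Q i) (Q j) ≡ (c + c) ∸ a × ⊓* M (Q i) (Q j) ≡ 1 ∸ ((c + c) ∸ a)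
  ⊓QQ≡ {a} {c} {i} {j} α≡a i≢j xi≡c xj≡c = ⊓≡ , a+b≡c⇒b≡c∸a _ (⊓+⊓*≡1 i≢j) ⊓≡
    where
    ⊓≡ : ⊓ M (Q i) (Q j) ≡ (c + c) ∸ a
    ⊓≡ = a+b≡c⇒b≡c∸a a (trans (α+⊓≡x+x i≢j) (cong₂ _+_ xi≡c xj≡c)) α≡a

  e*≡3∸α : ∀ {a i j} → α ≡ a → i ≢ j → e* i j ≡ 3 ∸ a
  e*≡3∸α α≡a i≢j = a+b≡c⇒b≡c∸a _ (α+e*≡3 i≢j) α≡a

  α≤⊓O : α ≤ ⊓ M O L
  α≤⊓O = e≤⊓O zero (suc zero)

  3∸α≤⊓*O : ∀ {a} → α ≡ a → 3 ∸ a ≤ ⊓* M O L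
  3∸α≤⊓*O α≡a = subst (_≤ ⊓* M O L) (e*≡3∸α α≡a (λ ())) (e*≤⊓*O zero (suc zero))

  punchIn-0≢1 : ∀ m → punchIn m zero ≢ punchIn m (suc zero)
  punchIn-0≢1 m = punchIn-≢ m (λ ())

  α≤⊓S : ∀ m → α ≤ ⊓ M (S m) L
  α≤⊓S m = subst (_≤ ⊓ M (S m) L) (e≡α (punchIn-0≢1 m)) (e≤⊓S (punchInᵢ≢i m zero) (punchInᵢ≢i m (suc zero)))

  3∸α≤⊓*S : ∀ {a} m → α ≡ a → 3 ∸ a ≤ ⊓* M (S m) L
  3∸α≤⊓*S m α≡a = subst (_≤ ⊓* M (S m) L) (e*≡3∸α α≡a (punchIn-0≢1 m))
                        (e*≤⊓*S (punchInᵢ≢i m zero) (punchInᵢ≢i m (suc zero)))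

  ⊓QR≡x : ∀ i → ⊓ M (Q i) R ≡ x i × ⊓* M (Q i) R ≡ x* i
  ⊓QR≡x i = ⊓-opposite≡⊓-L (Q-addable i) (Q∩R≡⊥ i) (subst FourSep S∪L≡∁Q∪R (proj₂ (S-addable i)))
    where
    S∪L≡∁Q∪R : S i ∪ L ≡ ∁ (Q i ∪ R)
    S∪L≡∁Q∪R = prove (L ∷ R ∷ Q i ∷ []) (v₀ ∩′ v₁ ∷ v₀ ∩′ v₂ ∷ []) (∁′ ((v₀ ∪′ v₁) ∪′ v₂) ∪′ v₀) (∁′ (v₂ ∪′ v₁))
                     (L∩R≡⊥ ∷ L∩Q≡⊥ i ∷ [])

  ⊓QQR≡x : ∀ {m i} → i ≢ m → ⊓ M (Q i) (Q m ∪ R) ≡ x i × ⊓* M (Q i) (Q m ∪ R) ≡ x* i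
  ⊓QQR≡x {m} {i} i≢m = ⊓-opposite≡⊓-L (Q-addable i) Q∩Q∪R≡⊥
                         (subst FourSep S∪L∩S∪L≡∁ (FourSep-∩ (proj₂ (S-addable i)) (proj₂ (S-addable m))))
    where
    ρ : Vec (Subset size) 4
    ρ = L ∷ R ∷ Q i ∷ Q m ∷ []
    Q∩Q∪R≡⊥ : Q i ∩ (Q m ∪ R) ≡ ⊥
    Q∩Q∪R≡⊥ = prove ρ (v₂ ∩′ v₃ ∷ v₂ ∩′ v₁ ∷ []) (v₂ ∩′ (v₃ ∪′ v₁)) ⊥′ (Q∩Q≡⊥ i m i≢m ∷ Q∩R≡⊥ i ∷ [])
    S∪L∩S∪L≡∁ : (S i ∪ L) ∩ (S m ∪ L) ≡ ∁ (Q i ∪ (Q m ∪ R))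
    S∪L∩S∪L≡∁ = prove ρ (v₀ ∩′ v₁ ∷ v₀ ∩′ v₂ ∷ v₀ ∩′ v₃ ∷ [])
                      ((∁′ ((v₀ ∪′ v₁) ∪′ v₂) ∪′ v₀) ∩′ (∁′ ((v₀ ∪′ v₁) ∪′ v₃) ∪′ v₀)) (∁′ (v₂ ∪′ (v₃ ∪′ v₁)))
                      (L∩R≡⊥ ∷ L∩Q≡⊥ i ∷ L∩Q≡⊥ m ∷ [])

  condB : ∀ {c i X} → ⊓ M (Q i) X ≡ x i × ⊓* M (Q i) X ≡ x* i → x i ≡ c →
          ⊓ M (Q i) L ≡ c × ⊓ M (Q i) X ≡ c × ⊓* M (Q i) L ≡ 2 ∸ c × ⊓* M (Q i) X ≡ 2 ∸ c
  condB {c} {i} (⊓≡x , ⊓*≡x*) x≡c = x≡c , trans ⊓≡x x≡c , x*≡2∸c , trans ⊓*≡x* x*≡2∸c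
    where
    x*≡2∸c : x* i ≡ 2 ∸ c
    x*≡2∸c = a+b≡c⇒b≡c∸a c (x+x*≡2 i) x≡c

  special⇒ : ∀ {i} → SpeciallyPlaced M L Q R i → (⊓ M L R ≡ 2 × x i ≡ 2) ⊎ (⊓* M L R ≡ 2 × x* i ≡ 2)
  special⇒ {i} (inj₁ (⊓LR≡2 , ⊓LQ≡2 , _)) = inj₁ (⊓LR≡2 , trans (⊓-comm (Q i) L) ⊓LQ≡2)
  special⇒ {i} (inj₂ (⊓*LR≡2 , ⊓*LQ≡2 , _)) = inj₂ (⊓*LR≡2 , trans (⊓*-comm (Q i) L) ⊓*LQ≡2)

  special⇐ : ∀ {i} → (⊓ M L R ≡ 2 × x i ≡ 2) ⊎ (⊓* M L R ≡ 2 × x* i ≡ 2) → SpeciallyPlaced M L Q R i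
  special⇐ {i} (inj₁ (⊓LR≡2 , x≡2)) =
    inj₁ (⊓LR≡2 , trans (⊓-comm L (Q i)) x≡2 , trans (⊓-comm R (Q i)) (trans (proj₁ (⊓QR≡x i)) x≡2))
  special⇐ {i} (inj₂ (⊓*LR≡2 , x*≡2)) =
    inj₂ (⊓*LR≡2 , trans (⊓*-comm L (Q i)) x*≡2 , trans (⊓*-comm R (Q i)) (trans (proj₂ (⊓QR≡x i)) x*≡2))

  x≡1⇒¬special : ∀ {i} → x i ≡ 1 → ¬ SpeciallyPlaced M L Q R i
  x≡1⇒¬special {i} x≡1 sp with special⇒ sp
  ... | inj₁ (_ , x≡2)  = contradiction (trans (sym x≡1) x≡2) λ ()
  ... | inj₂ (_ , x*≡2) = contradiction (trans (sym (a+b≡c⇒b≡c∸a 1 (x+x*≡2 i) x≡1)) x*≡2) λ ()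

  Goal : Set
  Goal = ((∀ i → ¬ SpeciallyPlaced M L Q R i) → OfFourTypes M L Q R)
         × (∀ i → SpeciallyPlaced M L Q R i → AbsorbedOfFourTypes M L Q R i)

  goal-without-special : (∀ i → ¬ SpeciallyPlaced M L Q R i) → OfFourTypes M L Q R → Goal
  goal-without-special none fourTypes = (λ _ → fourTypes) , (λ i sp → contradiction sp (none i))

  goal-with-special : ∀ m → SpeciallyPlaced M L Q R m → (∀ {i} → i ≢ m → ¬ SpeciallyPlaced M L Q R i) →
                      AbsorbedOfFourTypes M L Q R m → Goal
  goal-with-special m sp-m only-m absorbed = (λ none → contradiction sp-m (none m)) , absorb
    where
    absorb : ∀ i → SpeciallyPlaced M L Q R i → AbsorbedOfFourTypes M L Q R i
    absorb i sp-i with i ≟ m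
    ... | yes refl = absorbed
    ... | no i≢m   = contradiction sp-i (only-m i≢m)

  ends⇒¬special : ∀ {a b i} → ⊓ M L R ≡ a → ⊓* M L R ≡ b → a ≢ 2 → b ≢ 2 → ¬ SpeciallyPlaced M L Q R i
  ends⇒¬special ⊓LR≡a _ a≢2 _ (inj₁ (⊓LR≡2 , _)) = a≢2 (trans (sym ⊓LR≡a) ⊓LR≡2)
  ends⇒¬special _ ⊓*LR≡b _ b≢2 (inj₂ (⊓*LR≡2 , _)) = b≢2 (trans (sym ⊓*LR≡b) ⊓*LR≡2)

  ⊓O≤3 : ⊓ M O L ≤ 3
  ⊓O≤3 = subst (⊓ M O L ≤_) ⊓*LR+⊓O≡3 (m≤n+m _ _)

  ⊓*O≤3 : ⊓* M O L ≤ 3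
  ⊓*O≤3 = subst (⊓* M O L ≤_) ⊓LR+⊓*O≡3 (m≤n+m _ _)

  α≤3 : α ≤ 3
  α≤3 = subst (α ≤_) (α+e*≡3 {zero} {suc zero} (λ ())) (m≤m+n α _)

  α≡0⇒goal : α ≡ 0 → Goal
  α≡0⇒goal α≡0 = goal-without-special (λ i → ends⇒¬special ⊓LR≡0 ⊓*LR≡3 (λ ()) (λ ()))
                                       (inj₂ (inj₂ (inj₂ stretched)))
    where
    x≡0 : ∀ i → x i ≡ 0
    x≡0 i = n≤0⇒n≡0 (subst (x i ≤_) α≡0 (x≤α i))
    ⊓*LR≡3 : ⊓* M L R ≡ 3
    ⊓*LR≡3 = a+b≡c⇒a≡c∸b 0 ⊓*LR+⊓O≡3 (n≤0⇒n≡0 (⊓O≤ x≡0 (λ _ → z≤n)))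
    ⊓LR≡0 : ⊓ M L R ≡ 0
    ⊓LR≡0 = a+b≡c⇒a≡c∸b 3 ⊓LR+⊓*O≡3 (≤-antisym ⊓*O≤3 (3∸α≤⊓*O α≡0))
    stretched : Stretched M L Q R
    stretched = ⊓LR≡0 , ⊓*LR≡3 , (λ i j i≢j → ⊓QQ≡ α≡0 i≢j (x≡0 i) (x≡0 j)) , (λ i → condB (⊓QR≡x i) (x≡0 i))

  α≡3⇒goal : α ≡ 3 → Goal
  α≡3⇒goal α≡3 = goal-without-special (λ i → ends⇒¬special ⊓LR≡3 ⊓*LR≡0 (λ ()) (λ ()))
                                       (inj₂ (inj₂ (inj₁ squashed)))
    where
    x*≡0 : ∀ i → x* i ≡ 0
    x*≡0 i = n≤0⇒n≡0 (+-cancelˡ-≤ 3 _ 0 (subst (λ a → a + x* i ≤ 3) α≡3 (α+x*≤3 i)))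
    x≡2 : ∀ i → x i ≡ 2
    x≡2 i = a+b≡c⇒a≡c∸b 0 (x+x*≡2 i) (x*≡0 i)
    ⊓LR≡3 : ⊓ M L R ≡ 3
    ⊓LR≡3 = a+b≡c⇒a≡c∸b 0 ⊓LR+⊓*O≡3 (n≤0⇒n≡0 (⊓*O≤ x*≡0 (λ _ → z≤n)))
    ⊓*LR≡0 : ⊓* M L R ≡ 0
    ⊓*LR≡0 = a+b≡c⇒a≡c∸b 3 ⊓*LR+⊓O≡3 (≤-antisym ⊓O≤3 (subst (_≤ ⊓ M O L) α≡3 α≤⊓O))
    squashed : Squashed M L Q R
    squashed = ⊓LR≡3 , ⊓*LR≡0 , (λ i j i≢j → ⊓QQ≡ α≡3 i≢j (x≡2 i) (x≡2 j)) , (λ i → condB (⊓QR≡x i) (x≡2 i))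

  module _ (α≡1 : α ≡ 1) where

    x≤1 : ∀ i → x i ≤ 1
    x≤1 i = subst (x i ≤_) α≡1 (x≤α i)

    α≡1⇒spike : (∀ i → x i ≡ 1) → SpikeReminiscent M L Q R
    α≡1⇒spike x≡1 = ⊓LR≡1 , ⊓*LR≡2 , pairs , (λ i → condB (⊓QR≡x i) (x≡1 i))
      where
      pairs : ∀ i j → i ≢ j → ⊓ M (Q i) (Q j) ≡ 1 × ⊓* M (Q i) (Q j) ≡ 0
      pairs i j i≢j = ⊓QQ≡ α≡1 i≢j (x≡1 i) (x≡1 j)
      ⊓*LR≡2 : ⊓* M L R ≡ 2
      ⊓*LR≡2 = a+b≡c⇒a≡c∸b 1 ⊓*LR+⊓O≡3
                 (≤-antisym (⊓O≤ x≡1 (λ {i} {j} i≢j → ≤-reflexive (sym (proj₁ (pairs i j i≢j)))))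
                            (subst (_≤ ⊓ M O L) α≡1 α≤⊓O))
      ⊓LR≡1 : ⊓ M L R ≡ 1
      ⊓LR≡1 = a+b≡c⇒a≡c∸b 2 ⊓LR+⊓*O≡3
                (≤-antisym (⊓*O≤2 α≡1 (λ ()) (x≡1 zero) (x≡1 (suc zero))) (3∸α≤⊓*O α≡1))

    module Absorbing-x≡0 (m : Step) (xm≡0 : x m ≡ 0) where

      x≢0 : ∀ {i} → i ≢ m → x i ≢ 0
      x≢0 {i} i≢m xi≡0 = contradiction 1+⊓≡0 λ ()
        where
        1+⊓≡0 : 1 + ⊓ M (Q m) (Q i) ≡ 0
        1+⊓≡0 = trans (cong (_+ ⊓ M (Q m) (Q i)) (sym α≡1)) (trans (α+⊓≡x+x (≢-sym i≢m)) (cong₂ _+_ xm≡0 xi≡0))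

      x≡1 : ∀ {i} → i ≢ m → x i ≡ 1
      x≡1 {i} i≢m = n≤1⇒n≢0⇒n≡1 (x≤1 i) (x≢0 i≢m)

      xₒ≡1 : ∀ j → x (punchIn m j) ≡ 1
      xₒ≡1 j = x≡1 (punchInᵢ≢i m j)

      pairs : ∀ i j → i ≢ j → ⊓ M (Q (punchIn m i)) (Q (punchIn m j)) ≡ 1 × ⊓* M (Q (punchIn m i)) (Q (punchIn m j)) ≡ 0
      pairs i j i≢j = ⊓QQ≡ α≡1 (punchIn-≢ m i≢j) (xₒ≡1 i) (xₒ≡1 j)

      ⊓S≡1 : ⊓ M (S m) L ≡ 1
      ⊓S≡1 = ≤-antisym (⊓S≤ m xₒ≡1 (λ {i} {j} i≢j → ≤-reflexive (sym (proj₁ (pairs i j i≢j)))))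
                       (subst (_≤ ⊓ M (S m) L) α≡1 (α≤⊓S m))

      ⊓*S≡2 : ⊓* M (S m) L ≡ 2
      ⊓*S≡2 = ≤-antisym (≤-trans (⊓*S≤⊓*O m) (⊓*O≤2 α≡1 (punchIn-0≢1 m) (xₒ≡1 zero) (xₒ≡1 (suc zero))))
                        (3∸α≤⊓*S m α≡1)

      ⊓O≡1 : ⊓ M O L ≡ 1
      ⊓O≡1 = ≤-antisym (≤-trans (a+b≡c+0⇒a≤c (⊓O+⊓SQ≡⊓S+x m) xm≡0) (≤-reflexive ⊓S≡1)) (subst (_≤ ⊓ M O L) α≡1 α≤⊓O)

      special : SpeciallyPlaced M L Q R m
      special = special⇐ (inj₂ (a+b≡c⇒a≡c∸b 1 ⊓*LR+⊓O≡3 ⊓O≡1 , a+b≡c⇒b≡c∸a 0 (x+x*≡2 m) xm≡0))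

      absorbed : SpikeReminiscent M L (λ j → Q (punchIn m j)) (Q m ∪ R)
      absorbed = a+b≡c⇒a≡c∸b 2 (⊓LQR+⊓*S≡3 m) ⊓*S≡2 , a+b≡c⇒a≡c∸b 1 (⊓*LQR+⊓S≡3 m) ⊓S≡1 , pairs ,
                 (λ j → condB (⊓QQR≡x (punchInᵢ≢i m j)) (xₒ≡1 j))

      goal : Goal
      goal = goal-with-special m special (x≡1⇒¬special ∘ x≡1) (inj₁ absorbed)

    α≡1⇒goal : Goal
    α≡1⇒goal with any? (λ i → x i ≟ℕ 0)
    ... | yes (m , xm≡0) = Absorbing-x≡0.goal m xm≡0
    ... | no ∄x≡0 = goal-without-special (λ i → x≡1⇒¬special (x≡1 i)) (inj₁ (α≡1⇒spike x≡1))
      where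
      x≡1 : ∀ i → x i ≡ 1
      x≡1 i = n≤1⇒n≢0⇒n≡1 (x≤1 i) (λ xi≡0 → ∄x≡0 (i , xi≡0))

  module _ (α≡2 : α ≡ 2) where

    x*≤1 : ∀ i → x* i ≤ 1
    x*≤1 i = +-cancelˡ-≤ 2 _ 1 (subst (λ a → a + x* i ≤ 3) α≡2 (α+x*≤3 i))

    x*≡1⇒x≡1 : ∀ {i} → x* i ≡ 1 → x i ≡ 1
    x*≡1⇒x≡1 {i} = a+b≡c⇒a≡c∸b 1 (x+x*≡2 i)

    α≡2⇒paddle : (∀ i → x i ≡ 1) → PaddleReminiscent M L Q R
    α≡2⇒paddle x≡1 = ⊓LR≡2 , ⊓*LR≡1 , pairs , (λ i → condB (⊓QR≡x i) (x≡1 i))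
      where
      x*≡1 : ∀ i → x* i ≡ 1
      x*≡1 i = a+b≡c⇒b≡c∸a 1 (x+x*≡2 i) (x≡1 i)
      pairs : ∀ i j → i ≢ j → ⊓ M (Q i) (Q j) ≡ 0 × ⊓* M (Q i) (Q j) ≡ 1
      pairs i j i≢j = ⊓QQ≡ α≡2 i≢j (x≡1 i) (x≡1 j)
      ⊓LR≡2 : ⊓ M L R ≡ 2
      ⊓LR≡2 = a+b≡c⇒a≡c∸b 1 ⊓LR+⊓*O≡3
                (≤-antisym (⊓*O≤ x*≡1 (λ {i} {j} i≢j → ≤-reflexive (sym (proj₂ (pairs i j i≢j)))))
                           (3∸α≤⊓*O α≡2))
      ⊓*LR≡1 : ⊓* M L R ≡ 1
      ⊓*LR≡1 = a+b≡c⇒a≡c∸b 2 ⊓*LR+⊓O≡3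
                 (≤-antisym (⊓O≤2 α≡2 (λ ()) (x*≡1 zero) (x*≡1 (suc zero))) (subst (_≤ ⊓ M O L) α≡2 α≤⊓O))

    module Absorbing-x≡2 (m : Step) (xm≡2 : x m ≡ 2) where

      x*≢0 : ∀ {i} → i ≢ m → x* i ≢ 0
      x*≢0 {i} i≢m x*i≡0 = contradiction ⊓≤1 (subst (λ z → ¬ z ≤ 1) (sym ⊓≡2) λ { (s≤s ()) })
        where
        m≢i : m ≢ i
        m≢i = ≢-sym i≢m
        ⊓≡2 : ⊓ M (Q m) (Q i) ≡ 2
        ⊓≡2 = proj₁ (⊓QQ≡ α≡2 m≢i xm≡2 (a+b≡c⇒a≡c∸b 0 (x+x*≡2 i) x*i≡0))
        ⊓≤1 : ⊓ M (Q m) (Q i) ≤ 1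
        ⊓≤1 = subst (⊓ M (Q m) (Q i) ≤_) (⊓+⊓*≡1 m≢i) (m≤m+n (⊓ M (Q m) (Q i)) (⊓* M (Q m) (Q i)))

      x*≡1 : ∀ {i} → i ≢ m → x* i ≡ 1
      x*≡1 {i} i≢m = n≤1⇒n≢0⇒n≡1 (x*≤1 i) (x*≢0 i≢m)

      x*ₒ≡1 : ∀ j → x* (punchIn m j) ≡ 1
      x*ₒ≡1 j = x*≡1 (punchInᵢ≢i m j)

      xₒ≡1 : ∀ j → x (punchIn m j) ≡ 1
      xₒ≡1 j = x*≡1⇒x≡1 (x*ₒ≡1 j)

      pairs : ∀ i j → i ≢ j → ⊓ M (Q (punchIn m i)) (Q (punchIn m j)) ≡ 0 × ⊓* M (Q (punchIn m i)) (Q (punchIn m j)) ≡ 1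
      pairs i j i≢j = ⊓QQ≡ α≡2 (punchIn-≢ m i≢j) (xₒ≡1 i) (xₒ≡1 j)

      ⊓*S≡1 : ⊓* M (S m) L ≡ 1
      ⊓*S≡1 = ≤-antisym (⊓*S≤ m x*ₒ≡1 (λ {i} {j} i≢j → ≤-reflexive (sym (proj₂ (pairs i j i≢j)))))
                        (3∸α≤⊓*S m α≡2)

      ⊓S≡2 : ⊓ M (S m) L ≡ 2
      ⊓S≡2 = ≤-antisym (≤-trans (⊓S≤⊓O m) (⊓O≤2 α≡2 (punchIn-0≢1 m) (x*ₒ≡1 zero) (x*ₒ≡1 (suc zero))))
                       (subst (_≤ ⊓ M (S m) L) α≡2 (α≤⊓S m))

      ⊓*O≡1 : ⊓* M O L ≡ 1
      ⊓*O≡1 = ≤-antisym (≤-trans (a+b≡c+0⇒a≤c (⊓*O+⊓*SQ≡⊓*S+x* m) (a+b≡c⇒b≡c∸a 2 (x+x*≡2 m) xm≡2))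
                                 (≤-reflexive ⊓*S≡1))
                        (3∸α≤⊓*O α≡2)

      special : SpeciallyPlaced M L Q R m
      special = special⇐ (inj₁ (a+b≡c⇒a≡c∸b 1 ⊓LR+⊓*O≡3 ⊓*O≡1 , xm≡2))

      absorbed : PaddleReminiscent M L (λ j → Q (punchIn m j)) (Q m ∪ R)
      absorbed = a+b≡c⇒a≡c∸b 1 (⊓LQR+⊓*S≡3 m) ⊓*S≡1 , a+b≡c⇒a≡c∸b 2 (⊓*LQR+⊓S≡3 m) ⊓S≡2 , pairs ,
                 (λ j → condB (⊓QQR≡x (punchInᵢ≢i m j)) (xₒ≡1 j))

      goal : Goal
      goal = goal-with-special m special (λ i≢m → x≡1⇒¬special (x*≡1⇒x≡1 (x*≡1 i≢m))) (inj₂ (inj₁ absorbed))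

    α≡2⇒goal : Goal
    α≡2⇒goal with any? (λ i → x i ≟ℕ 2)
    ... | yes (m , xm≡2) = Absorbing-x≡2.goal m xm≡2
    ... | no ∄x≡2 = goal-without-special (λ i → x≡1⇒¬special (x≡1 i)) (inj₂ (inj₁ (α≡2⇒paddle x≡1)))
      where
      x≡1 : ∀ i → x i ≡ 1
      x≡1 i = x*≡1⇒x≡1 (n≤1⇒n≢0⇒n≡1 (x*≤1 i) (λ x*i≡0 → ∄x≡2 (i , a+b≡c⇒a≡c∸b 0 (x+x*≡2 i) x*i≡0)))

  goal : Goal
  goal = by-α α refl
    where
    by-α : ∀ a → α ≡ a → Goal
    by-α 0 = α≡0⇒goal
    by-α 1 = α≡1⇒goal
    by-α 2 = α≡2⇒goal
    by-α 3 = α≡3⇒goal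
    by-α (suc (suc (suc (suc a)))) α≡4+a = contradiction (subst (_≤ 3) α≡4+a α≤3) λ { (s≤s (s≤s (s≤s ()))) }

theorem1p1 : (M : Matroid) (n : ℕ) (L R : Subset (Matroid.size M)) (Q : Fin n → Subset (Matroid.size M))
    → 5 ≤ n
    → Flexipath4c M 2 L Q R
    → ((∀ i → ¬ SpeciallyPlaced M L Q R i) → OfFourTypes M L Q R)
    × (∀ i → SpeciallyPlaced M L Q R i → AbsorbedOfFourTypes M L Q R i)
theorem1p1 M (suc (suc (suc (suc (suc n))))) L R Q (s≤s (s≤s (s≤s (s≤s (s≤s z≤n))))) flexi =
  Flexipath.goal M n L R Q flexi
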